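{- Let $u\le w$ in $\mathbb{P}^*$, order the maximal chains of $[u,w]$ lexicographically by label sequence, and let $C$ be a maximal chain of $[u,w]$ that is weakly decreasing and ends at a normal embedding $\eta_u$ of $u$ into $w$. Then $C$ is critical, $\mathcal{I}(C)=\mathcal{J}(C)$, and $\#\mathcal{I}(C)=d(\eta_u)+2D(\eta_u)-1$.
   Context: $\mathbb{P}^*$: finite words over the positive integers, $u\le w$ iff $w$ has a subword $w(i_1)\cdots w(i_l)$ ($i_1<\dots<i_l$, $l=|u|$) with $u(j)\le w(i_j)$. Covers: $y$ is obtained from $x$ by decreasing one entry by $1$ (deleting it if it becomes $0$). An expansion of $u$ is a word over nonnegative integers whose restriction to its nonzero positions is $u$; an embedding of $u$ into $w$ is an expansion $\eta_u$ of length $|w|$ with $\eta_u(i)\le w(i)$ for all $i$. A run of $k$'s in $w$ is a maximal index interval $[r,t]$ with $w(r)=\dots=w(t)=k$. An embedding $\eta_u$ is normal if $\eta_u(i)\in\{w(i),w(i)-1,0\}$ for all $i$, and for every run $[r,t]$ of $k$'s in $w$: if $k=1$ then $\eta_u(i)\ne0$ for $r<i\le t$; if $k\ge2$ then $\eta_u(r)\neq 0$. $d(\eta_u)=\#\{i:\eta_u(i)=w(i)-1\}$; $D(\eta_u)=\#\{i:\eta_u(i)=0,\ w(i)\ge2\}$. Labels: for a maximal chain $C: w=v_0\gtrdot\cdots\gtrdot v_d=u$ set $\eta_{v_0}=w$; for $j\ge1$, $\eta_{v_j}$ is the expansion of $v_j$ obtained from $\eta_{v_{j-1}}$ by subtracting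 $1$ at a single position $i$, where, if that entry goes from $1$ to $0$, $i$ is the position of the leftmost $1$ of the run of $1$'s of $v_{j-1}$ containing the deleted entry; the label is $l_j=i$, $l(C)=(l_1,\dots,l_d)$, and $C$ ends at $\eta_{v_d}$. $C$ is weakly decreasing if $l_1\ge\cdots\ge l_d$. Chains are ordered lexicographically by label sequence. For $0\le i<j\le d$, $j-i\ge2$, $C(v_i,v_j)=\{v_{i+1},\dots,v_{j-1}\}$; it is skipped if $C\setminus C(v_i,v_j)\subseteq C'$ for some maximal chain $C'<C$; an MSI is a skipped interval strictly containing no other skipped interval. $\mathcal{I}(C)$ is the set of MSIs, listed $I_1,I_2,\dots$ by position of first element along $C$. $\mathcal{J}(C)$: $J_1=I_1$; given $J_1,\dots,J_s$, replace the remaining $I_k$ by $I_k\setminus(J_1\cup\dots\cup J_s)$, discard empty ones and those strictly containing another modified set, and let $J_{s+1}$ be the first remaining; stop when none remain. $C$ is critical if $\bigcup\mathcal{J}(C)=\{v_1,\dots,v_{d-1}\}$. -}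

module Defs where

open import Data.Nat using (ℕ; zero; suc; _+_; _*_; _∸_; _≤_; _<_; _≥_; _≡ᵇ_; _≤ᵇ_)
open import Data.Bool using (Bool; true; false; if_then_else_; not; _∧_; _∨_)
open import Data.List using (List; []; _∷_; length; map; concat; _++_)
open import Data.List.Relation.Unary.All using (All)
open import Data.List.Relation.Binary.Pointwise using (Pointwise)
open import Data.List.Membership.Propositional using (_∈_)
open import Data.Maybe using (Maybe; just; nothing)
open import Data.Product using (Σ; _×_; _,_; proj₁; proj₂; ∃)
open import Data.Sum using (_⊎_)
open import Data.Empty using (⊥)
open import Relation.Binary.PropositionalEquality using (_≡_; _≢_)

-- Words of ℙ* are lists of natural numbers all of whose entries are ≥ 1.
Word : Set
Word = List ℕ

Positive : Word → Set
Positive w = All (λ x → 1 ≤ x) w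

-- The order on ℙ*: u ≼ w iff w has a subword dominating u entrywise.
data _≼_ : Word → Word → Set where
  ≼-[]   : ∀ {w} → [] ≼ w
  ≼-skip : ∀ {u a w} → u ≼ w → u ≼ (a ∷ w)
  ≼-take : ∀ {x u a w} → x ≤ a → u ≼ w → (x ∷ u) ≼ (a ∷ w)

-- entry at position i (0-based), 0 if out of range
at : List ℕ → ℕ → ℕ
at [] _ = 0
at (x ∷ xs) zero = x
at (x ∷ xs) (suc i) = at xs i

nth : {A : Set} → List A → ℕ → Maybe A
nth [] _ = nothing
nth (x ∷ xs) zero = just x
nth (x ∷ xs) (suc i) = nth xs i

headM : {A : Set} → List A → Maybe A
headM [] = nothing
headM (x ∷ _) = just x

lastM : {A : Set} → List A → Maybe A
lastM [] = nothing
lastM (x ∷ []) = just x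
lastM (x ∷ y ∷ ys) = lastM (y ∷ ys)

decAt : Word → ℕ → Word
decAt [] _ = []
decAt (zero ∷ xs) zero = zero ∷ xs
decAt (suc zero ∷ xs) zero = xs
decAt (suc (suc k) ∷ xs) zero = suc k ∷ xs
decAt (x ∷ xs) (suc i) = x ∷ decAt xs i

_⋗_ : Word → Word → Set
x ⋗ y = Σ ℕ λ i → i < length x × y ≡ decAt x i

-- maximal chains w = v₀ ⋗ v₁ ⋗ ⋯ ⋗ v_d = u of [u,w], as the list (v₀,…,v_d)
data CoverChain : List Word → Set where
  single : ∀ v → CoverChain (v ∷ [])
  cons   : ∀ {v v' vs} → v ⋗ v' → CoverChain (v' ∷ vs) → CoverChain (v ∷ v' ∷ vs)

MaxChain : Word → Word → List Word → Set
MaxChain u w C = CoverChain C × headM C ≡ just w × lastM C ≡ just u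

nz : List ℕ → List ℕ
nz [] = []
nz (zero ∷ xs) = nz xs
nz (suc k ∷ xs) = suc k ∷ nz xs

subAt : List ℕ → ℕ → List ℕ
subAt [] _ = []
subAt (x ∷ xs) zero = (x ∸ 1) ∷ xs
subAt (x ∷ xs) (suc i) = x ∷ subAt xs i

lastNZ : List ℕ → Maybe ℕ
lastNZ xs = lastM (nz xs)

take : ℕ → List ℕ → List ℕ
take zero _ = []
take (suc n) [] = []
take (suc n) (x ∷ xs) = x ∷ take n xs

-- Admissible labelled step at position i of the expansion η: the entry is
-- nonzero, and if it goes 1 → 0 then i is the leftmost 1 of its run of 1's
-- in the word nz η (i.e. the preceding entry of nz η, if any, is not 1).
ValidStep : List ℕ → ℕ → Set
ValidStep η i = i < length η × 1 ≤ at η i × (at η i ≡ 1 → lastNZ (take i η) ≢ just 1)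

-- Labels η vs l η' : starting from expansion η, the chain continues through the
-- words vs, the label sequence is l and the chain ends at the expansion η'.
data Labels : List ℕ → List Word → List ℕ → List ℕ → Set where
  done : ∀ {η} → Labels η [] [] η
  step : ∀ {η v vs i l η'} → ValidStep η i → nz (subAt η i) ≡ v →
         Labels (subAt η i) vs l η' → Labels η (v ∷ vs) (i ∷ l) η'

-- label sequence l of the chain C = (v₀,…,v_d), ending at expansion η  (η_{v₀} = v₀ = w)
ChainLabels : List Word → List ℕ → List ℕ → Set
ChainLabels [] l η = ⊥
ChainLabels (v ∷ vs) l η = Labels v vs l η

data _<lex_ : List ℕ → List ℕ → Set where
  here  : ∀ {a b xs ys} → a < b → (a ∷ xs) <lex (b ∷ ys)
  there : ∀ {a xs ys} → xs <lex ys → (a ∷ xs) <lex (a ∷ ys)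

ChainLt : Word → Word → List Word → List Word → Set
ChainLt u w C' C = MaxChain u w C' ×
  Σ (List ℕ) λ l' → Σ (List ℕ) λ l → Σ (List ℕ) λ η' → Σ (List ℕ) λ η →
    ChainLabels C' l' η' × ChainLabels C l η × l' <lex l

-- C(v_i,v_j) = {v_{i+1},…,v_{j-1}} is skipped (intervals recorded by index pairs (i,j))
Skipped : Word → Word → List Word → ℕ × ℕ → Set
Skipped u w C (i , j) = 2 + i ≤ j × j < length C ×
  Σ (List Word) λ C' → ChainLt u w C' C ×
    (∀ k → k < length C → (k ≤ i ⊎ j ≤ k) → Σ Word λ v → nth C k ≡ just v × v ∈ C')

-- minimal skipped interval: skipped, and strictly contains no other skipped interval
-- (chain elements are distinct, so containment of C(v_i',v_j') in C(v_i,v_j) is i ≤ i', j' ≤ j)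
MSI : Word → Word → List Word → ℕ × ℕ → Set
MSI u w C (i , j) = Skipped u w C (i , j) ×
  (∀ i' j' → Skipped u w C (i' , j') → i ≤ i' → j' ≤ j → (i ≡ i' × j ≡ j'))

-- sets of chain indices, as increasing lists of naturals
upFrom : ℕ → ℕ → List ℕ
upFrom a zero = []
upFrom a (suc n) = a ∷ upFrom (suc a) n

-- index set {i+1,…,j-1} of C(v_i,v_j)
interior : ℕ × ℕ → List ℕ
interior (i , j) = upFrom (suc i) (j ∸ suc i)

memb : ℕ → List ℕ → Bool
memb x [] = false
memb x (y ∷ ys) = (x ≡ᵇ y) ∨ memb x ys

filterB : {A : Set} → (A → Bool) → List A → List A
filterB p [] = []
filterB p (x ∷ xs) = if p x then x ∷ filterB p xs else filterB p xs

anyB : {A : Set} → (A → Bool) → List A → Bool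
anyB p [] = false
anyB p (x ∷ xs) = p x ∨ anyB p xs

allB : {A : Set} → (A → Bool) → List A → Bool
allB p [] = true
allB p (x ∷ xs) = p x ∧ allB p xs

diff : List ℕ → List ℕ → List ℕ
diff A B = filterB (λ x → not (memb x B)) A

subsetB : List ℕ → List ℕ → Bool
subsetB A B = allB (λ x → memb x B) A

strictSubB : List ℕ → List ℕ → Bool
strictSubB A B = subsetB A B ∧ not (subsetB B A)

nonemptyB : List ℕ → Bool
nonemptyB [] = false
nonemptyB (_ ∷ _) = true

nextJ : List (List ℕ) → List ℕ → Maybe (List ℕ)
nextJ Iss U = headM remaining
  where
  mods      = filterB nonemptyB (map (λ I → diff I U) Iss)
  remaining = filterB (λ m → not (anyB (λ m' → strictSubB m' m) mods)) mods

-- J_{s+1}, J_{s+2}, … given U = J₁ ∪ ⋯ ∪ J_s (fuel bounds the number of rounds;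
-- each round selects a different I_k, so length Iss rounds suffice)
Jrest : ℕ → List (List ℕ) → List ℕ → List (List ℕ)
Jrest zero Iss U = []
Jrest (suc f) Iss U with nextJ Iss U
... | nothing = []
... | just J  = J ∷ Jrest f Iss (U ++ J)

Jof : List (List ℕ) → List (List ℕ)
Jof [] = []
Jof (I₁ ∷ Iss) = I₁ ∷ Jrest (length (I₁ ∷ Iss)) (I₁ ∷ Iss) I₁

Critical : List Word → List (List ℕ) → Set
Critical C Js = ∀ k → (k ∈ concat Js → 1 ≤ k × suc k < length C) ×
                      (1 ≤ k × suc k < length C → k ∈ concat Js)

IsEmbedding : Word → Word → List ℕ → Set
IsEmbedding u w η = nz η ≡ u × Pointwise _≤_ η w

Normal : Word → Word → List ℕ → Set
Normal u w η = IsEmbedding u w η ×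
  (∀ i → i < length w → (at η i ≡ at w i ⊎ suc (at η i) ≡ at w i ⊎ at η i ≡ 0)) ×
  (∀ i → suc i < length w → at w i ≡ 1 → at w (suc i) ≡ 1 → at η (suc i) ≢ 0) ×
  (∀ r → r < length w → 2 ≤ at w r → (∀ r' → r ≡ suc r' → at w r' ≢ at w r) → at η r ≢ 0)

dCount : List ℕ → List ℕ → ℕ
dCount (e ∷ es) (x ∷ xs) = (if suc e ≡ᵇ x then 1 else 0) + dCount es xs
dCount _ _ = 0

DCount : List ℕ → List ℕ → ℕ
DCount (e ∷ es) (x ∷ xs) = (if (e ≡ᵇ 0) ∧ (2 ≤ᵇ x) then 1 else 0) + DCount es xs
DCount _ _ = 0

-- Because the labels decrease weakly, each position p of w is decremented in a single run of
-- w(p) - η(p) consecutive steps. The minimal skipped intervals are exactly the descents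
-- C(v_i, v_{i+2}) with l_i > l_{i+1}, where swapping the two steps gives a smaller chain, and the
-- runs of length at least 2: normality forces such a run to empty w(p) with w(p - 1) = w(p), so
-- decrementing p - 1 instead gives a smaller chain, while no smaller chain can rejoin C inside a
-- run otherwise. These intervals are pairwise disjoint and cover v_1, ..., v_{d-1}, hence
-- 𝒥(C) = 𝓘(C) and C is critical, and #𝓘(C) + 1 = Σ_p min(w(p) - η(p), 2) = d(η) + 2D(η).

module Submission where

open import Defs hiding (take)
open import Data.Bool using (Bool; true; false; not; _∨_; _∧_; T; if_then_else_)
open import Data.Bool.Properties using (∨-zeroʳ; ∧-inverseʳ)
open import Data.Empty using (⊥; ⊥-elim)
open import Data.List using (List; []; _∷_; _++_; length; map; concat; replicate; take; drop; filter)
open import Data.List.Properties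
  using (length-++; length-map; length-take; length-filter; ++-assoc; take-all; map-++; map-id-local;
         filter-++; filter-accept; filter-reject; filter-none; ∷-injectiveˡ; ∷-injectiveʳ)
open import Data.List.Membership.Propositional using (_∈_; _∉_)
open import Data.List.Membership.Propositional.Properties
  using (∈-++⁺ˡ; ∈-++⁺ʳ; ∈-++⁻; ∈-concat⁺′; ∈-concat⁻′; ∈-map⁺; ∈-map⁻)
open import Data.List.Relation.Binary.Disjoint.Propositional using (Disjoint)
import Data.List.Relation.Binary.Disjoint.Propositional.Properties as Disjoint
open import Data.List.Relation.Binary.Pointwise as Pointwise using (Pointwise; []; _∷_; Pointwise-length)
open import Data.List.Relation.Binary.Subset.Propositional using (_⊆_)
open import Data.List.Relation.Unary.All as All using (All; []; _∷_)
import Data.List.Relation.Unary.All.Properties as Allₚ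
open import Data.List.Relation.Unary.AllPairs as AllPairs using (AllPairs; []; _∷_)
open import Data.List.Relation.Unary.Any using (here; there)
open import Data.List.Relation.Unary.Linked as Linked using (Linked; _∷_)
open import Data.List.Relation.Unary.Linked.Properties as Linkedₚ using (Linked⇒AllPairs)
open import Data.Maybe using (Maybe; just; nothing)
open import Data.Maybe.Properties using (just-injective)
open import Data.Nat
  using (ℕ; zero; suc; pred; _+_; _*_; _∸_; _⊓_; _≤_; _<_; _≥_; z≤n; s≤s; s≤s⁻¹; _≟_; _≤?_; _<?_; _≡ᵇ_; _≤ᵇ_; >-nonZero)
open import Data.Nat.ListAction using (sum)
open import Data.Nat.Properties
open import Data.Nat.Solver using (module +-*-Solver)
open import Data.Product using (Σ; ∃-syntax; _×_; _,_; proj₁; proj₂)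
open import Data.Sum using (_⊎_; inj₁; inj₂; [_,_]′)
open import Data.Unit using (tt)
open import Function.Base using (_∘_; case_of_)
open import Function.Bundles using (_⇔_; mk⇔; Equivalence)
open import Function.Properties.Equivalence using () renaming (refl to ⇔-refl)
open import Relation.Binary.Definitions using (tri<; tri≈; tri>)
open import Relation.Binary.PropositionalEquality
  using (_≡_; _≢_; refl; sym; trans; cong; cong₂; subst; subst₂; module ≡-Reasoning)
open import Relation.Nullary using (¬_; Dec; yes; no)
open import Relation.Unary using (Decidable)

-- Expansions

length-subAt : ∀ ζ i → length (subAt ζ i) ≡ length ζ
length-subAt [] i = refl
length-subAt (x ∷ ζ) zero = refl
length-subAt (x ∷ ζ) (suc i) = cong suc (length-subAt ζ i)

at-subAt-≢ : ∀ ζ {i r} → i ≢ r → at (subAt ζ i) r ≡ at ζ r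
at-subAt-≢ [] i≢r = refl
at-subAt-≢ (x ∷ ζ) {zero} {zero} i≢r = ⊥-elim (i≢r refl)
at-subAt-≢ (x ∷ ζ) {zero} {suc r} i≢r = refl
at-subAt-≢ (x ∷ ζ) {suc i} {zero} i≢r = refl
at-subAt-≢ (x ∷ ζ) {suc i} {suc r} i≢r = at-subAt-≢ ζ (i≢r ∘ cong suc)

at-subAt-≡ : ∀ ζ i → at (subAt ζ i) i ≡ at ζ i ∸ 1
at-subAt-≡ [] i = refl
at-subAt-≡ (x ∷ ζ) zero = refl
at-subAt-≡ (x ∷ ζ) (suc i) = at-subAt-≡ ζ i

subAt-comm : ∀ ζ a b → subAt (subAt ζ a) b ≡ subAt (subAt ζ b) a
subAt-comm [] a b = refl
subAt-comm (x ∷ ζ) zero zero = refl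
subAt-comm (x ∷ ζ) zero (suc b) = refl
subAt-comm (x ∷ ζ) (suc a) zero = refl
subAt-comm (x ∷ ζ) (suc a) (suc b) = cong (x ∷_) (subAt-comm ζ a b)

take-subAt : ∀ ζ {p i} → p ≤ i → take p (subAt ζ i) ≡ take p ζ
take-subAt ζ {zero} p≤i = refl
take-subAt [] {suc p} p≤i = refl
take-subAt (x ∷ ζ) {suc p} {suc i} (s≤s p≤i) = cong (x ∷_) (take-subAt ζ p≤i)

subAt-++-length : ∀ P t R → subAt (P ++ t ∷ R) (length P) ≡ P ++ (t ∸ 1) ∷ R
subAt-++-length [] t R = refl
subAt-++-length (x ∷ P) t R = cong (x ∷_) (subAt-++-length P t R)

subAt-++ˡ : ∀ P R {q} → q < length P → subAt (P ++ R) q ≡ subAt P q ++ R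
subAt-++ˡ (x ∷ P) R {zero} _ = refl
subAt-++ˡ (x ∷ P) R {suc q} (s≤s q<P) = cong (x ∷_) (subAt-++ˡ P R q<P)

at-++-length : ∀ P t R → at (P ++ t ∷ R) (length P) ≡ t
at-++-length [] t R = refl
at-++-length (x ∷ P) t R = at-++-length P t R

at-++-≡ : ∀ P {p x} R → length P ≡ p → at (P ++ x ∷ R) p ≡ x
at-++-≡ P {x = x} R refl = at-++-length P x R

at-take : ∀ p ζ {n} → n < p → at (take p ζ) n ≡ at ζ n
at-take (suc p) [] _ = refl
at-take (suc p) (x ∷ ζ) {zero} _ = refl
at-take (suc p) (x ∷ ζ) {suc n} (s≤s n<p) = at-take p ζ n<p

length-take≤ : ∀ {A : Set} p (xs : List A) → p ≤ length xs → length (take p xs) ≡ p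
length-take≤ p xs p≤ = trans (length-take p xs) (m≤n⇒m⊓n≡m p≤)

length-snoc : ∀ (P : List ℕ) a → length (P ++ a ∷ []) ≡ suc (length P)
length-snoc [] a = refl
length-snoc (x ∷ P) a = cong suc (length-snoc P a)

take-suc-at : ∀ ζ r → r < length ζ → take (suc r) ζ ≡ take r ζ ++ at ζ r ∷ []
take-suc-at (x ∷ ζ) zero _ = refl
take-suc-at (x ∷ ζ) (suc r) (s≤s r<ζ) = cong (x ∷_) (take-suc-at ζ r r<ζ)

split-at : ∀ ζ p → p < length ζ → ζ ≡ take p ζ ++ at ζ p ∷ drop (suc p) ζ
split-at (x ∷ ζ) zero _ = refl
split-at (x ∷ ζ) (suc p) (s≤s p<ζ) = cong (x ∷_) (split-at ζ p p<ζ)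

All-take : ∀ {P : ℕ → Set} xs k → (∀ n → n < k → n < length xs → P (at xs n)) → All P (take k xs)
All-take xs zero _ = []
All-take [] (suc k) _ = []
All-take (x ∷ xs) (suc k) f = f zero (s≤s z≤n) (s≤s z≤n) ∷ All-take xs k (λ n n<k n<xs → f (suc n) (s≤s n<k) (s≤s n<xs))

positive-at : ∀ {w} → Positive w → ∀ n → n < length w → 1 ≤ at w n
positive-at (px ∷ _) zero _ = px
positive-at (_ ∷ pw) (suc n) (s≤s n<w) = positive-at pw n n<w

nz-∷ : ∀ x {η η′} → nz η ≡ nz η′ → nz (x ∷ η) ≡ nz (x ∷ η′)
nz-∷ zero e = e
nz-∷ (suc x) e = cong (suc x ∷_) e

nz-∷-positive : ∀ {x R} → 1 ≤ x → nz (x ∷ R) ≡ x ∷ nz R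
nz-∷-positive {suc x} _ = refl

nz-++ : ∀ A B → nz (A ++ B) ≡ nz A ++ nz B
nz-++ [] B = refl
nz-++ (zero ∷ A) B = nz-++ A B
nz-++ (suc x ∷ A) B = cong (suc x ∷_) (nz-++ A B)

nz-positive : ∀ {P} → Positive P → nz P ≡ P
nz-positive [] = refl
nz-positive {suc x ∷ P} (_ ∷ ps) = cong (suc x ∷_) (nz-positive ps)

nz-swap : ∀ x R → nz (0 ∷ x ∷ R) ≡ nz (x ∷ 0 ∷ R)
nz-swap zero R = refl
nz-swap (suc x) R = refl

length-nz : ∀ ζ → length (nz ζ) ≤ length ζ
length-nz [] = z≤n
length-nz (zero ∷ ζ) = m≤n⇒m≤1+n (length-nz ζ)
length-nz (suc x ∷ ζ) = s≤s (length-nz ζ)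

length-nz-subAt : ∀ P q → length (nz (subAt P q)) ≤ length P
length-nz-subAt P q = subst (length (nz (subAt P q)) ≤_) (length-subAt P q) (length-nz (subAt P q))

sum-nz : ∀ ζ → sum (nz ζ) ≡ sum ζ
sum-nz [] = refl
sum-nz (zero ∷ ζ) = sum-nz ζ
sum-nz (suc x ∷ ζ) = cong (suc x +_) (sum-nz ζ)

sum-subAt : ∀ ζ i → 1 ≤ at ζ i → suc (sum (subAt ζ i)) ≡ sum ζ
sum-subAt (suc x ∷ ζ) zero _ = refl
sum-subAt (x ∷ ζ) (suc i) a = trans (sym (+-suc x _)) (cong (x +_) (sum-subAt ζ i a))

subAt-≤ : ∀ ζ i → Pointwise _≤_ (subAt ζ i) ζ
subAt-≤ [] i = []
subAt-≤ (x ∷ ζ) zero = m∸n≤m x 1 ∷ Pointwise.refl ≤-refl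
subAt-≤ (x ∷ ζ) (suc i) = ≤-refl ∷ subAt-≤ ζ i

nth⇒∈take : ∀ {A : Set} {v : A} xs {k n} → nth xs k ≡ just v → k < n → v ∈ take n xs
nth⇒∈take (x ∷ xs) {zero} {suc n} refl _ = here refl
nth⇒∈take (x ∷ xs) {suc k} {suc n} e (s≤s k<n) = there (nth⇒∈take xs e k<n)

nth⇒∈drop : ∀ {A : Set} {v : A} xs {k n} → nth xs k ≡ just v → n ≤ k → v ∈ drop n xs
nth⇒∈drop (x ∷ xs) {zero} {zero} refl _ = here refl
nth⇒∈drop (x ∷ xs) {suc k} {zero} e _ = there (nth⇒∈drop xs e z≤n)
nth⇒∈drop (x ∷ xs) {suc k} {suc n} e (s≤s n≤k) = nth⇒∈drop xs e n≤k

∈⇒nth : ∀ {A : Set} {v : A} xs → v ∈ xs → ∃[ k ] nth xs k ≡ just v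
∈⇒nth (x ∷ xs) (here refl) = zero , refl
∈⇒nth (x ∷ xs) (there v∈xs) with ∈⇒nth xs v∈xs
... | k , e = suc k , e

nth⇒< : ∀ {A : Set} {v : A} xs {k} → nth xs k ≡ just v → k < length xs
nth⇒< (x ∷ xs) {zero} _ = s≤s z≤n
nth⇒< (x ∷ xs) {suc k} e = s≤s (nth⇒< xs e)

linked≥-antitone : ∀ {l} → Linked _≥_ l → ∀ {a b} → a ≤ b → b < length l → at l b ≤ at l a
linked≥-antitone {x ∷ l} _ {zero} {zero} _ _ = ≤-refl
linked≥-antitone {x ∷ y ∷ l} (x≥y ∷ lk) {zero} {suc b} _ (s≤s b<l) =
  ≤-trans (linked≥-antitone lk {zero} {b} z≤n b<l) x≥y
linked≥-antitone {x ∷ y ∷ l} (_ ∷ lk) {suc a} {suc b} (s≤s a≤b) (s≤s b<l) = linked≥-antitone lk a≤b b<l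

<lex-++ : ∀ xs {a b ys zs} → a < b → (xs ++ a ∷ ys) <lex (xs ++ b ∷ zs)
<lex-++ [] a<b = here a<b
<lex-++ (x ∷ xs) a<b = there (<lex-++ xs a<b)

<lex⇒firstDifference : ∀ {l′ l} → l′ <lex l →
  ∃[ k ] k < length l′ × k < length l × take k l′ ≡ take k l × at l′ k < at l k
<lex⇒firstDifference (here a<b) = zero , s≤s z≤n , s≤s z≤n , refl , a<b
<lex⇒firstDifference (there {a = a} p) with <lex⇒firstDifference p
... | k , k<l′ , k<l , same , lt = suc k , s≤s k<l′ , s≤s k<l , cong (a ∷_) same , lt

lastFrom : {A : Set} → Maybe A → List A → Maybe A
lastFrom m [] = m
lastFrom m (y ∷ ys) = lastFrom (just y) ys

lastM≡lastFrom : ∀ {A : Set} (ys : List A) → lastM ys ≡ lastFrom nothing ys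
lastM≡lastFrom [] = refl
lastM≡lastFrom (y ∷ ys) = go y ys
  where
  go : ∀ {A : Set} (y : A) ys → lastM (y ∷ ys) ≡ lastFrom (just y) ys
  go y [] = refl
  go y (z ∷ zs) = go z zs

-- ValidStep relative to a context: m is the last nonzero entry preceding the list, which
-- decides whether a leading 1 of the list may be deleted.
ValidStepAfter : Maybe ℕ → List ℕ → ℕ → Set
ValidStepAfter m [] i = ⊥
ValidStepAfter m (x ∷ η) zero = 1 ≤ x × (x ≡ 1 → m ≢ just 1)
ValidStepAfter m (zero ∷ η) (suc i) = ValidStepAfter m η i
ValidStepAfter m (suc x ∷ η) (suc i) = ValidStepAfter (just (suc x)) η i

private
  ValidStepFrom : Maybe ℕ → List ℕ → ℕ → Set
  ValidStepFrom m η i = i < length η × 1 ≤ at η i × (at η i ≡ 1 → lastFrom m (nz (Defs.take i η)) ≢ just 1)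

  from⇒after : ∀ m η i → ValidStepFrom m η i → ValidStepAfter m η i
  from⇒after m (x ∷ η) zero (_ , x≥1 , c) = x≥1 , c
  from⇒after m (zero ∷ η) (suc i) (s≤s l , a , c) = from⇒after m η i (l , a , c)
  from⇒after m (suc x ∷ η) (suc i) (s≤s l , a , c) = from⇒after (just (suc x)) η i (l , a , c)

  after⇒from : ∀ m η i → ValidStepAfter m η i → ValidStepFrom m η i
  after⇒from m (x ∷ η) zero (x≥1 , c) = s≤s z≤n , x≥1 , c
  after⇒from m (zero ∷ η) (suc i) v with after⇒from m η i v
  ... | l , a , c = s≤s l , a , c
  after⇒from m (suc x ∷ η) (suc i) v with after⇒from (just (suc x)) η i v
  ... | l , a , c = s≤s l , a , c

validStep⇔after : ∀ η i → ValidStep η i ⇔ ValidStepAfter nothing η i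
validStep⇔after η i = mk⇔
  (λ (l , a , c) → from⇒after nothing η i (l , a , λ e → c e ∘ trans last≡))
  (λ v → let (l , a , c) = after⇒from nothing η i v in l , a , λ e → c e ∘ trans (sym last≡))
  where
  last≡ : lastM (nz (Defs.take i η)) ≡ lastFrom nothing (nz (Defs.take i η))
  last≡ = lastM≡lastFrom (nz (Defs.take i η))

validStep⇒after : ∀ {η i} → ValidStep η i → ValidStepAfter nothing η i
validStep⇒after = Equivalence.to (validStep⇔after _ _)

after⇒validStep : ∀ {η i} → ValidStepAfter nothing η i → ValidStep η i
after⇒validStep = Equivalence.from (validStep⇔after _ _)

validAfterOne⇒keepsLeadingOne : ∀ ζ b → ValidStepAfter (just 1) ζ b → nz ζ ≢ 1 ∷ nz (subAt ζ b)
validAfterOne⇒keepsLeadingOne (zero ∷ ζ) zero (() , _)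
validAfterOne⇒keepsLeadingOne (zero ∷ ζ) (suc b) v e = validAfterOne⇒keepsLeadingOne ζ b v e
validAfterOne⇒keepsLeadingOne (suc zero ∷ ζ) zero (_ , c) _ = c refl refl
validAfterOne⇒keepsLeadingOne (suc zero ∷ ζ) (suc b) v e = validAfterOne⇒keepsLeadingOne ζ b v (∷-injectiveʳ e)

validStepAfter-unique : ∀ m η i i′ → ValidStepAfter m η i → ValidStepAfter m η i′ →
                        nz (subAt η i) ≡ nz (subAt η i′) → i ≡ i′
validStepAfter-unique m (zero ∷ η) zero _ (() , _) _ _
validStepAfter-unique m (zero ∷ η) (suc i) zero _ (() , _) _
validStepAfter-unique m (zero ∷ η) (suc i) (suc i′) v v′ e = cong suc (validStepAfter-unique m η i i′ v v′ e)
validStepAfter-unique m (suc x ∷ η) zero zero v v′ e = refl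
validStepAfter-unique m (suc zero ∷ η) zero (suc i′) v v′ e = ⊥-elim (validAfterOne⇒keepsLeadingOne η i′ v′ e)
validStepAfter-unique m (suc zero ∷ η) (suc i) zero v v′ e = ⊥-elim (validAfterOne⇒keepsLeadingOne η i v (sym e))
validStepAfter-unique m (suc x ∷ η) (suc i) (suc i′) v v′ e =
  cong suc (validStepAfter-unique (just (suc x)) η i i′ v v′ (∷-injectiveʳ e))

validStep-unique : ∀ {η i i′} → ValidStep η i → ValidStep η i′ → nz (subAt η i) ≡ nz (subAt η i′) → i ≡ i′
validStep-unique {η} v v′ = validStepAfter-unique nothing η _ _ (validStep⇒after v) (validStep⇒after v′)

validStepAfter-realises : ∀ m ζ i → 1 ≤ at ζ i →
  (∃[ i′ ] ValidStepAfter m ζ i′ × nz (subAt ζ i′) ≡ nz (subAt ζ i)) ⊎ (m ≡ just 1 × 1 ∷ nz (subAt ζ i) ≡ nz ζ)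
validStepAfter-realises m (zero ∷ ζ) (suc i) a with validStepAfter-realises m ζ i a
... | inj₁ (i′ , v , e) = inj₁ (suc i′ , v , e)
... | inj₂ p = inj₂ p
validStepAfter-realises m (suc (suc y) ∷ ζ) zero a = inj₁ (zero , (s≤s z≤n , λ ()) , refl)
validStepAfter-realises nothing (suc zero ∷ ζ) zero a = inj₁ (zero , (s≤s z≤n , λ _ ()) , refl)
validStepAfter-realises (just x) (suc zero ∷ ζ) zero a with x ≟ 1
... | yes refl = inj₂ (refl , refl)
... | no x≢1 = inj₁ (zero , (s≤s z≤n , λ _ e → x≢1 (just-injective e)) , refl)
validStepAfter-realises m (suc y ∷ ζ) (suc i) a with validStepAfter-realises (just (suc y)) ζ i a
... | inj₁ (i′ , v , e) = inj₁ (suc i′ , v , cong (suc y ∷_) e)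
validStepAfter-realises m (suc zero ∷ ζ) (suc i) a | inj₂ (_ , e) with validStepAfter-realises m (suc zero ∷ ζ) zero (s≤s z≤n)
... | inj₁ (i′ , v , e′) = inj₁ (i′ , v , trans e′ (sym e))
... | inj₂ (m≡1 , _) = inj₂ (m≡1 , cong (1 ∷_) e)

-- Deleting any 1 of a run of 1's gives the same word as deleting its first one.
validStep-realises : ∀ ζ i → 1 ≤ at ζ i → ∃[ i′ ] ValidStep ζ i′ × nz (subAt ζ i′) ≡ nz (subAt ζ i)
validStep-realises ζ i a with validStepAfter-realises nothing ζ i a
... | inj₁ (i′ , v , e) = i′ , after⇒validStep v , e

validStepAfter-transfer : ∀ m η η′ i → nz η ≡ nz η′ → ValidStepAfter m η i →
                          ∃[ i′ ] ValidStepAfter m η′ i′ × nz (subAt η′ i′) ≡ nz (subAt η i)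
validStepAfter-transfer m (zero ∷ η) η′ (suc i) e v = validStepAfter-transfer m η η′ i e v
validStepAfter-transfer m (suc x ∷ η) (zero ∷ η′) i e v with validStepAfter-transfer m (suc x ∷ η) η′ i e v
... | i′ , v′ , e′ = suc i′ , v′ , e′
validStepAfter-transfer m (suc x ∷ η) (suc y ∷ η′) i e v with ∷-injectiveˡ e | ∷-injectiveʳ e
validStepAfter-transfer m (suc x ∷ η) (suc x ∷ η′) zero e v | refl | e′ = zero , v , nz-∷ x (sym e′)
validStepAfter-transfer m (suc x ∷ η) (suc x ∷ η′) (suc i) e v | refl | e′
  with validStepAfter-transfer (just (suc x)) η η′ i e′ v
... | i′ , v′ , e″ = suc i′ , v′ , cong (suc x ∷_) e″

validStep-transfer : ∀ {η η′ i} → nz η ≡ nz η′ → ValidStep η i →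
                     ∃[ i′ ] ValidStep η′ i′ × nz (subAt η′ i′) ≡ nz (subAt η i)
validStep-transfer {η} {η′} {i} e v with validStepAfter-transfer nothing η η′ i e (validStep⇒after v)
... | i′ , v′ , e′ = i′ , after⇒validStep v′ , e′

validStepAfter-subAt : ∀ m ζ {p q} → ValidStepAfter m (subAt ζ p) q → q < p → ValidStepAfter m ζ q
validStepAfter-subAt m (x ∷ ζ) {suc p} {zero} v _ = v
validStepAfter-subAt m (zero ∷ ζ) {suc p} {suc q} v (s≤s q<p) = validStepAfter-subAt m ζ v q<p
validStepAfter-subAt m (suc x ∷ ζ) {suc p} {suc q} v (s≤s q<p) = validStepAfter-subAt (just (suc x)) ζ v q<p

validStep-subAt : ∀ {ζ p q} → ValidStep (subAt ζ p) q → q < p → ValidStep ζ q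
validStep-subAt {ζ} v q<p = after⇒validStep (validStepAfter-subAt nothing ζ (validStep⇒after v) q<p)

validStepAfter-++ : ∀ m P n T → ValidStepAfter m (P ++ suc (suc n) ∷ T) (length P)
validStepAfter-++ m [] n T = s≤s z≤n , λ ()
validStepAfter-++ m (zero ∷ P) n T = validStepAfter-++ m P n T
validStepAfter-++ m (suc x ∷ P) n T = validStepAfter-++ (just (suc x)) P n T

-- Labelled paths

cover-subAt : ∀ ζ i → 1 ≤ at ζ i → nz ζ ⋗ nz (subAt ζ i)
cover-subAt (zero ∷ ζ) (suc i) a = cover-subAt ζ i a
cover-subAt (suc zero ∷ ζ) zero a = zero , s≤s z≤n , refl
cover-subAt (suc (suc x) ∷ ζ) zero a = zero , s≤s z≤n , refl
cover-subAt (suc zero ∷ ζ) (suc i) a with cover-subAt ζ i a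
... | j , j< , e = suc j , s≤s j< , cong (1 ∷_) e
cover-subAt (suc (suc x) ∷ ζ) (suc i) a with cover-subAt ζ i a
... | j , j< , e = suc j , s≤s j< , cong (suc (suc x) ∷_) e

run : List ℕ → List ℕ → List ℕ
run η [] = η
run η (i ∷ l) = run (subAt η i) l

run-take-suc : ∀ η l {k} → k < length l → run η (take (suc k) l) ≡ subAt (run η (take k l)) (at l k)
run-take-suc η (i ∷ l) {zero} _ = refl
run-take-suc η (i ∷ l) {suc k} (s≤s k<l) = run-take-suc (subAt η i) l k<l

length-run : ∀ ζ l → length (run ζ l) ≡ length ζ
length-run ζ [] = refl
length-run ζ (i ∷ l) = trans (length-run (subAt ζ i) l) (length-subAt ζ i)

run-≤ : ∀ ζ l → Pointwise _≤_ (run ζ l) ζ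
run-≤ ζ [] = Pointwise.refl ≤-refl
run-≤ ζ (i ∷ l) = Pointwise.transitive ≤-trans (run-≤ (subAt ζ i) l) (subAt-≤ ζ i)

run-take-antitone : ∀ ζ l {a b} → a ≤ b → Pointwise _≤_ (run ζ (take b l)) (run ζ (take a l))
run-take-antitone ζ l {zero} {b} _ = run-≤ ζ (take b l)
run-take-antitone ζ [] {suc a} {suc b} _ = Pointwise.refl ≤-refl
run-take-antitone ζ (i ∷ l) {suc a} {suc b} (s≤s a≤b) = run-take-antitone (subAt ζ i) l a≤b

take-run : ∀ ζ l {p} → All (p ≤_) l → take p (run ζ l) ≡ take p ζ
take-run ζ [] [] = refl
take-run ζ (i ∷ l) (p≤i ∷ p≤l) = trans (take-run (subAt ζ i) l p≤l) (take-subAt ζ p≤i)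

labels-length : ∀ {η vs l e} → Labels η vs l e → length vs ≡ length l
labels-length done = refl
labels-length (step _ _ p) = cong suc (labels-length p)

labels-end : ∀ {η vs l e} → Labels η vs l e → run η l ≡ e
labels-end done = refl
labels-end (step _ _ p) = labels-end p

labels-take : ∀ {η vs l e} n → Labels η vs l e → Labels η (take n vs) (take n l) (run η (take n l))
labels-take zero p = done
labels-take (suc n) done = done
labels-take (suc n) (step v e p) = step v e (labels-take n p)

labels-drop : ∀ {η vs l e} n → Labels η vs l e → Labels (run η (take n l)) (drop n vs) (drop n l) e
labels-drop zero p = p
labels-drop (suc n) done = done
labels-drop (suc n) (step v e p) = labels-drop n p

labels-nth : ∀ {η vs l e} → Labels η vs l e → ∀ k → k ≤ length l → nth (nz η ∷ vs) k ≡ just (nz (run η (take k l)))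
labels-nth _ zero _ = refl
labels-nth (step v e p) (suc zero) _ = cong just (sym e)
labels-nth (step v e p) (suc (suc k)) (s≤s k<l) = labels-nth p (suc k) k<l

labels-valid : ∀ {η vs l e} → Labels η vs l e → ∀ k → k < length l → ValidStep (run η (take k l)) (at l k)
labels-valid (step v e p) zero _ = v
labels-valid (step v e p) (suc k) (s≤s k<l) = labels-valid p k k<l

labels-rank : ∀ {η vs l e} → Labels η vs l e → ∀ k → k ≤ length l → sum (run η (take k l)) + k ≡ sum η
labels-rank p zero _ = +-identityʳ _
labels-rank {η} (step {i = i} (_ , a , _) e p) (suc k) (s≤s k≤l) =
  trans (+-suc _ k) (trans (cong suc (labels-rank p k k≤l)) (sum-subAt η i a))

labels-coverChain : ∀ {η vs l e} → Labels η vs l e → CoverChain (nz η ∷ vs)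
labels-coverChain {η} done = single (nz η)
labels-coverChain {η} (step {i = i} (_ , a , _) refl p) = cons (cover-subAt η i a) (labels-coverChain p)

labels-last : ∀ {η vs l e} → Labels η vs l e → lastM (nz η ∷ vs) ≡ just (nz e)
labels-last done = refl
labels-last (step v refl done) = refl
labels-last (step v refl (step v′ e′ p)) = labels-last (step v′ e′ p)

labels-++ : ∀ {η vs₁ l₁ e₁ vs₂ l₂ e₂} → Labels η vs₁ l₁ e₁ → Labels e₁ vs₂ l₂ e₂ → Labels η (vs₁ ++ vs₂) (l₁ ++ l₂) e₂
labels-++ done q = q
labels-++ (step v e p) q = step v e (labels-++ p q)

labels-transfer : ∀ {η η′ vs l e} → nz η ≡ nz η′ → Labels η vs l e →
                  ∃[ l′ ] ∃[ e′ ] Labels η′ vs l′ e′ × nz e′ ≡ nz e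
labels-transfer {η′ = η′} η≈η′ done = [] , η′ , done , sym η≈η′
labels-transfer η≈η′ (step v e p) with validStep-transfer η≈η′ v
... | i′ , v′ , e′ with labels-transfer (sym e′) p
... | l′ , e″ , p′ , q = i′ ∷ l′ , e″ , step v′ (trans e′ e) p′ , q

labels-unique : ∀ {η vs l e l′ e′} → Labels η vs l e → Labels η vs l′ e′ → l ≡ l′
labels-unique done done = refl
labels-unique (step {i = i} v e p) (step v′ e′ p′) with validStep-unique v v′ (trans e (sym e′))
... | refl = cong (i ∷_) (labels-unique p p′)

decrementTo1 : ∀ P T n → ∃[ mids ] Labels (P ++ suc n ∷ T) mids (replicate n (length P)) (P ++ 1 ∷ T)
decrementTo1 P T zero = [] , done
decrementTo1 P T (suc n) with decrementTo1 P T n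
... | mids , path = nz (P ++ suc n ∷ T) ∷ mids ,
  step (after⇒validStep (validStepAfter-++ nothing P n T)) (cong nz (subAt-++-length P (suc (suc n)) T))
       (subst (λ ζ → Labels ζ mids (replicate n (length P)) (P ++ 1 ∷ T)) (sym (subAt-++-length P (suc (suc n)) T)) path)

data Detour (ζ₀ : List ℕ) (v : Word) (bound : ℕ) : Set where
  detour : ∀ {mids q lm ζ} → Labels ζ₀ (mids ++ v ∷ []) (q ∷ lm) ζ → nz ζ ≡ v → q < bound → Detour ζ₀ v bound

-- Emptying the first of two equal entries gives the same word as emptying the second.
emptyFirstOfPair : ∀ Q n R {p} → length Q < p → Detour (Q ++ suc (suc n) ∷ suc (suc n) ∷ R) (nz (Q ++ suc (suc n) ∷ 0 ∷ R)) p
emptyFirstOfPair Q n R Q<p =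
  detour {mids = proj₁ decrement} (labels-++ (proj₂ decrement) (step (proj₁ (proj₂ realised)) reaches done)) reaches Q<p
  where
  a : ℕ
  a = suc (suc n)
  decrement : ∃[ mids ] Labels (Q ++ a ∷ a ∷ R) mids (replicate (suc n) (length Q)) (Q ++ 1 ∷ a ∷ R)
  decrement = decrementTo1 Q (a ∷ R) (suc n)
  realised : ∃[ i′ ] ValidStep (Q ++ 1 ∷ a ∷ R) i′ × nz (subAt (Q ++ 1 ∷ a ∷ R) i′) ≡ nz (subAt (Q ++ 1 ∷ a ∷ R) (length Q))
  realised = validStep-realises (Q ++ 1 ∷ a ∷ R) (length Q) (≤-reflexive (sym (at-++-length Q 1 (a ∷ R))))
  i′ : ℕ
  i′ = proj₁ realised
  reaches : nz (subAt (Q ++ 1 ∷ a ∷ R) i′) ≡ nz (Q ++ a ∷ 0 ∷ R)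
  reaches = begin
    nz (subAt (Q ++ 1 ∷ a ∷ R) i′)          ≡⟨ proj₂ (proj₂ realised) ⟩
    nz (subAt (Q ++ 1 ∷ a ∷ R) (length Q))  ≡⟨ cong nz (subAt-++-length Q 1 (a ∷ R)) ⟩
    nz (Q ++ 0 ∷ a ∷ R)                     ≡⟨ nz-++ Q (0 ∷ a ∷ R) ⟩
    nz Q ++ nz (0 ∷ a ∷ R)                  ≡⟨ cong (nz Q ++_) (nz-swap a R) ⟩
    nz Q ++ nz (a ∷ 0 ∷ R)                  ≡⟨ nz-++ Q (a ∷ 0 ∷ R) ⟨
    nz (Q ++ a ∷ 0 ∷ R)                     ∎
    where open ≡-Reasoning

≼-length : ∀ {u w} → u ≼ w → length u ≤ length w
≼-length ≼-[] = z≤n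
≼-length (≼-skip p) = m≤n⇒m≤1+n (≼-length p)
≼-length (≼-take _ p) = s≤s (≼-length p)

≼⇒pointwise : ∀ {u w} → u ≼ w → length w ≤ length u → Pointwise _≤_ u w
≼⇒pointwise {w = []} ≼-[] _ = []
≼⇒pointwise (≼-skip p) w≤u = ⊥-elim (<-irrefl refl (≤-trans (s≤s (≼-length p)) w≤u))
≼⇒pointwise (≼-take x≤a p) (s≤s w≤u) = x≤a ∷ ≼⇒pointwise p w≤u

pointwise⇒nz≼ : ∀ {ζ₁ ζ₂} → Pointwise _≤_ ζ₁ ζ₂ → nz ζ₁ ≼ nz ζ₂
pointwise⇒nz≼ [] = ≼-[]
pointwise⇒nz≼ {zero ∷ _} {zero ∷ _} (_ ∷ p) = pointwise⇒nz≼ p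
pointwise⇒nz≼ {zero ∷ _} {suc _ ∷ _} (_ ∷ p) = ≼-skip (pointwise⇒nz≼ p)
pointwise⇒nz≼ {suc _ ∷ _} {suc _ ∷ _} (x≤y ∷ p) = ≼-take x≤y (pointwise⇒nz≼ p)

pointwise-at : ∀ {u w} → Pointwise _≤_ u w → ∀ n → at u n ≤ at w n
pointwise-at [] n = z≤n
pointwise-at (x≤y ∷ p) zero = x≤y
pointwise-at (x≤y ∷ p) (suc n) = pointwise-at p n

¬pointwise-decremented : ∀ P q → Positive P → q < length P → ∀ Y Z → length Z ≤ length Y →
                         ¬ Pointwise _≤_ (P ++ Y) (nz (subAt P q) ++ Z)
¬pointwise-decremented (zero ∷ P) zero (() ∷ _)
¬pointwise-decremented (suc zero ∷ P) zero _ _ Y Z Z≤Y pw = 1+n≰n (begin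
  suc (length (P ++ Y))    ≡⟨ Pointwise-length pw ⟩
  length (nz P ++ Z)       ≡⟨ length-++ (nz P) ⟩
  length (nz P) + length Z ≤⟨ +-mono-≤ (length-nz P) Z≤Y ⟩
  length P + length Y      ≡⟨ length-++ P ⟨
  length (P ++ Y)          ∎)
  where open ≤-Reasoning
¬pointwise-decremented (suc (suc a) ∷ P) zero _ _ Y Z _ (h ∷ _) = <-irrefl refl h
¬pointwise-decremented (suc a ∷ P) (suc q) (_ ∷ ps) (s≤s q<P) Y Z Z≤Y (_ ∷ pw) =
  ¬pointwise-decremented P q ps q<P Y Z Z≤Y pw

¬≼-decremented : ∀ P q → Positive P → q < length P → ∀ Y Z → length Z ≤ length Y →
                 ¬ ((P ++ Y) ≼ (nz (subAt P q) ++ Z))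
¬≼-decremented P q ps q<P Y Z Z≤Y h = ¬pointwise-decremented P q ps q<P Y Z Z≤Y (≼⇒pointwise h (begin
  length (nz (subAt P q) ++ Z)         ≡⟨ length-++ (nz (subAt P q)) ⟩
  length (nz (subAt P q)) + length Z   ≤⟨ +-mono-≤ (length-nz-subAt P q) Z≤Y ⟩
  length P + length Y                  ≡⟨ length-++ P ⟨
  length (P ++ Y)                      ∎))
  where open ≤-Reasoning

-- Comparing lengths forces the embedding to be pointwise, and then a sits above t.
¬≼-lastEntry : ∀ P B {a t} Y → length B ≤ length P → t < a → ¬ (((P ++ a ∷ []) ++ Y) ≼ (B ++ t ∷ Y))
¬≼-lastEntry P B {a} {t} Y B≤P t<a h = <⇒≱ t<a (begin
  a                               ≡⟨ at-++-length P a Y ⟨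
  at (P ++ a ∷ Y) (length P)      ≡⟨ cong (λ X → at X (length P)) (++-assoc P (a ∷ []) Y) ⟨
  at ((P ++ a ∷ []) ++ Y) (length P) ≤⟨ pointwise-at pw (length P) ⟩
  at (B ++ t ∷ Y) (length P)      ≡⟨ cong (at (B ++ t ∷ Y)) P≡B ⟩
  at (B ++ t ∷ Y) (length B)      ≡⟨ at-++-length B t Y ⟩
  t                               ∎)
  where
  open ≤-Reasoning
  lengthˡ : length ((P ++ a ∷ []) ++ Y) ≡ suc (length P + length Y)
  lengthˡ = trans (cong length (++-assoc P (a ∷ []) Y)) (trans (length-++ P) (+-suc _ _))
  lengthʳ : length (B ++ t ∷ Y) ≡ suc (length B + length Y)
  lengthʳ = trans (length-++ B) (+-suc _ _)
  P≤B : length P ≤ length B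
  P≤B = +-cancelʳ-≤ (length Y) _ _ (s≤s⁻¹ (subst₂ _≤_ lengthˡ lengthʳ (≼-length h)))
  P≡B : length P ≡ length B
  P≡B = ≤-antisym P≤B B≤P
  pw : Pointwise _≤_ ((P ++ a ∷ []) ++ Y) (B ++ t ∷ Y)
  pw = ≼⇒pointwise h (subst₂ _≤_ (sym lengthʳ) (sym lengthˡ) (s≤s (+-monoˡ-≤ (length Y) B≤P)))

¬≼-decrementedBefore : ∀ P {a} q → Positive (P ++ a ∷ []) → q ≤ length P → ∀ {t} Y → t < a →
                       ¬ (((P ++ a ∷ []) ++ Y) ≼ (nz (subAt (P ++ a ∷ []) q) ++ t ∷ Y))
¬≼-decrementedBefore [] {suc zero} zero _ _ Y t<a h = ¬≼-lastEntry [] [] Y z≤n t<a h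
¬≼-decrementedBefore [] {suc (suc a)} zero _ _ Y t<a (≼-skip h) = ¬≼-lastEntry [] [] Y z≤n t<a h
¬≼-decrementedBefore [] {suc (suc a)} zero _ _ Y t<a (≼-take le _) = <-irrefl refl le
¬≼-decrementedBefore (zero ∷ P) q (() ∷ _)
¬≼-decrementedBefore (suc zero ∷ P) {a} zero (_ ∷ ps) _ Y t<a h =
  ¬≼-lastEntry (1 ∷ P) (P ++ a ∷ []) Y (≤-reflexive (length-snoc P a)) t<a
    (subst (λ B → ((1 ∷ P ++ a ∷ []) ++ Y) ≼ (B ++ _ ∷ Y)) (nz-positive ps) h)
¬≼-decrementedBefore (suc (suc x) ∷ P) {a} zero _ _ Y t<a (≼-skip h) =
  ¬≼-lastEntry (suc (suc x) ∷ P) (nz (P ++ a ∷ [])) Y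
    (≤-trans (length-nz (P ++ a ∷ [])) (≤-reflexive (length-snoc P a))) t<a h
¬≼-decrementedBefore (suc (suc x) ∷ P) zero _ _ Y t<a (≼-take le _) = <-irrefl refl le
¬≼-decrementedBefore (suc x ∷ P) {a} (suc q) _ _ Y t<a (≼-skip h) =
  ¬≼-lastEntry (suc x ∷ P) (nz (subAt (P ++ a ∷ []) q)) Y
    (≤-trans (length-nz-subAt (P ++ a ∷ []) q) (≤-reflexive (length-snoc P a))) t<a h
¬≼-decrementedBefore (suc x ∷ P) (suc q) (_ ∷ ps) (s≤s q≤P) Y t<a (≼-take _ h) =
  ¬≼-decrementedBefore P q ps q≤P Y t<a h

-- The selection of 𝒥(C)

≡ᵇ-refl : ∀ x → (x ≡ᵇ x) ≡ true
≡ᵇ-refl zero = refl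
≡ᵇ-refl (suc x) = ≡ᵇ-refl x

≢⇒≡ᵇ-false : ∀ {x y} → x ≢ y → (x ≡ᵇ y) ≡ false
≢⇒≡ᵇ-false {x} {y} x≢y with x ≡ᵇ y in eq
... | true = ⊥-elim (x≢y (≡ᵇ⇒≡ x y (subst T (sym eq) tt)))
... | false = refl

memb⁺ : ∀ {x B} → x ∈ B → memb x B ≡ true
memb⁺ {x} (here refl) rewrite ≡ᵇ-refl x = refl
memb⁺ {x} {y ∷ B} (there x∈B) = trans (cong ((x ≡ᵇ y) ∨_) (memb⁺ x∈B)) (∨-zeroʳ _)

memb-false : ∀ {x} B → x ∉ B → memb x B ≡ false
memb-false [] x∉B = refl
memb-false (y ∷ B) x∉B rewrite ≢⇒≡ᵇ-false (x∉B ∘ here) = memb-false B (x∉B ∘ there)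

filterB-all : ∀ {A : Set} (p : A → Bool) {xs} → All (λ x → p x ≡ true) xs → filterB p xs ≡ xs
filterB-all p [] = refl
filterB-all p (px ∷ pxs) rewrite px = cong (_ ∷_) (filterB-all p pxs)

filterB-none : ∀ {A : Set} (p : A → Bool) {xs} → All (λ x → p x ≡ false) xs → filterB p xs ≡ []
filterB-none p [] = refl
filterB-none p (px ∷ pxs) rewrite px = filterB-none p pxs

filterB-++ : ∀ {A : Set} (p : A → Bool) xs ys → filterB p (xs ++ ys) ≡ filterB p xs ++ filterB p ys
filterB-++ p [] ys = refl
filterB-++ p (x ∷ xs) ys with p x
... | true = cong (x ∷_) (filterB-++ p xs ys)
... | false = filterB-++ p xs ys

anyB-none : ∀ {A : Set} (p : A → Bool) {xs} → All (λ x → p x ≡ false) xs → anyB p xs ≡ false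
anyB-none p [] = refl
anyB-none p (px ∷ pxs) rewrite px = anyB-none p pxs

diff-disjoint : ∀ A U → Disjoint A U → diff A U ≡ A
diff-disjoint A U A#U = filterB-all _ (All.tabulate λ x∈A → cong not (memb-false U (A#U ∘ (x∈A ,_))))

diff-⊆ : ∀ A U → A ⊆ U → diff A U ≡ []
diff-⊆ A U A⊆U = filterB-none _ (All.tabulate λ x∈A → cong not (memb⁺ (A⊆U x∈A)))

strictSubB-self : ∀ A → strictSubB A A ≡ false
strictSubB-self A = ∧-inverseʳ (subsetB A A)

strictSubB-disjoint : ∀ {a A} B → Disjoint (a ∷ A) B → strictSubB (a ∷ A) B ≡ false
strictSubB-disjoint {a} B a∷A#B rewrite memb-false B (a∷A#B ∘ (here refl ,_)) = refl

AllPairs-∈ : ∀ {A : Set} {R : A → A → Set} {xs x y} → AllPairs R xs → x ∈ xs → y ∈ xs → y ≡ x ⊎ R x y ⊎ R y x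
AllPairs-∈ (_ ∷ _) (here refl) (here refl) = inj₁ refl
AllPairs-∈ (Rx ∷ _) (here refl) (there y∈) = inj₂ (inj₁ (All.lookup Rx y∈))
AllPairs-∈ (Rx ∷ _) (there x∈) (here refl) = inj₂ (inj₂ (All.lookup Rx x∈))
AllPairs-∈ (_ ∷ Rs) (there x∈) (there y∈) = AllPairs-∈ Rs x∈ y∈

NonEmpty : List ℕ → Set
NonEmpty A = nonemptyB A ≡ true

-- Removing U empties exactly the sets already chosen, and nonempty disjoint sets are never
-- strict subsets of one another, so nothing else is discarded.
nextJ-disjoint : ∀ Done Rest U → All (_⊆ U) Done → All (λ R → Disjoint R U) Rest →
                 AllPairs Disjoint Rest → All NonEmpty Rest → nextJ (Done ++ Rest) U ≡ headM Rest
nextJ-disjoint Done Rest U covered apart disjoint nonEmpty = begin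
  nextJ (Done ++ Rest) U
    ≡⟨ cong (λ M → headM (filterB (λ m → not (anyB (λ m′ → strictSubB m′ m) M)) M)) modified ⟩
  headM (filterB keep Rest)
    ≡⟨ cong headM (filterB-all keep (All.tabulate kept)) ⟩
  headM Rest ∎
  where
  open ≡-Reasoning
  keep : List ℕ → Bool
  keep m = not (anyB (λ m′ → strictSubB m′ m) Rest)
  modified : filterB nonemptyB (map (λ I → diff I U) (Done ++ Rest)) ≡ Rest
  modified = begin
    filterB nonemptyB (map (λ I → diff I U) (Done ++ Rest))
      ≡⟨ cong (filterB nonemptyB) (map-++ (λ I → diff I U) Done Rest) ⟩
    filterB nonemptyB (map (λ I → diff I U) Done ++ map (λ I → diff I U) Rest)
      ≡⟨ filterB-++ nonemptyB (map (λ I → diff I U) Done) _ ⟩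
    filterB nonemptyB (map (λ I → diff I U) Done) ++ filterB nonemptyB (map (λ I → diff I U) Rest)
      ≡⟨ cong₂ _++_ (filterB-none nonemptyB (Allₚ.map⁺ (All.map (λ {D} (D⊆U : D ⊆ U) → cong nonemptyB (diff-⊆ D U D⊆U)) covered)))
                    (cong (filterB nonemptyB) (map-id-local (All.map (λ {R} (R#U : Disjoint R U) → diff-disjoint R U R#U) apart))) ⟩
    filterB nonemptyB Rest
      ≡⟨ filterB-all nonemptyB nonEmpty ⟩
    Rest ∎
  kept : ∀ {m} → m ∈ Rest → keep m ≡ true
  kept {m} m∈ = cong not (anyB-none _ (All.tabulate λ {m′} m′∈ → notStrict (AllPairs-∈ disjoint m∈ m′∈) (All.lookup nonEmpty m′∈)))
    where
    notStrict : ∀ {m′} → m′ ≡ m ⊎ Disjoint m m′ ⊎ Disjoint m′ m → NonEmpty m′ → strictSubB m′ m ≡ false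
    notStrict (inj₁ refl) _ = strictSubB-self m
    notStrict {_ ∷ _} (inj₂ (inj₁ m#m′)) _ = strictSubB-disjoint m (Disjoint.sym m#m′)
    notStrict {_ ∷ _} (inj₂ (inj₂ m′#m)) _ = strictSubB-disjoint m m′#m

disjoint-++ : ∀ {R U J : List ℕ} → Disjoint R U → Disjoint R J → Disjoint R (U ++ J)
disjoint-++ {U = U} R#U R#J (x∈R , x∈U++J) = [ R#U ∘ (x∈R ,_) , R#J ∘ (x∈R ,_) ]′ (∈-++⁻ U x∈U++J)

Jrest-disjoint : ∀ f Done Rest U → length Rest ≤ f → All (_⊆ U) Done →
                 All (λ R → Disjoint R U) Rest → AllPairs Disjoint Rest → All NonEmpty Rest → Jrest f (Done ++ Rest) U ≡ Rest
Jrest-disjoint zero Done [] U _ covered apart disjoint nonEmpty = refl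
Jrest-disjoint (suc f) Done [] U _ covered apart disjoint nonEmpty
  rewrite nextJ-disjoint Done [] U covered apart disjoint nonEmpty = refl
Jrest-disjoint (suc f) Done (J ∷ Rest) U (s≤s Rest≤f) covered apart@(J#U ∷ Rest#U) disjoint@(J#Rest ∷ Rest#) nonEmpty@(_ ∷ ne)
  rewrite nextJ-disjoint Done (J ∷ Rest) U covered apart disjoint nonEmpty =
  cong (J ∷_) (subst (λ Iss → Jrest f Iss (U ++ J) ≡ Rest) (++-assoc Done (J ∷ []) Rest)
    (Jrest-disjoint f (Done ++ J ∷ []) Rest (U ++ J) Rest≤f covered′ apart′ Rest# ne))
  where
  covered′ : All (_⊆ U ++ J) (Done ++ J ∷ [])
  covered′ = Allₚ.++⁺ (All.map (λ {D} (D⊆U : D ⊆ U) {x} x∈D → ∈-++⁺ˡ (D⊆U x∈D)) covered) (∈-++⁺ʳ U ∷ [])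
  apart′ : All (λ R → Disjoint R (U ++ J)) Rest
  apart′ = All.zipWith (λ {R} (R#U,J#R : Disjoint R U × Disjoint J R) {v} → disjoint-++ (proj₁ R#U,J#R) (Disjoint.sym (proj₂ R#U,J#R)) {v})
                       (Rest#U , J#Rest)

Jof-disjoint : ∀ Iss → AllPairs Disjoint Iss → All NonEmpty Iss → Jof Iss ≡ Iss
Jof-disjoint [] _ _ = refl
Jof-disjoint (I ∷ Iss) disjoint@(I#Iss ∷ Iss#) (_ ∷ ne) =
  cong (I ∷_) (Jrest-disjoint (length (I ∷ Iss)) (I ∷ []) Iss I (n≤1+n _) ((λ x∈I → x∈I) ∷ [])
                               (All.map (λ {R} (I#R : Disjoint I R) {v} → Disjoint.sym I#R {v}) I#Iss) Iss# ne)

∈-upFrom⁻ : ∀ {a n k} → k ∈ upFrom a n → a ≤ k × k < a + n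
∈-upFrom⁻ {a} {suc n} (here refl) = ≤-refl , m<m+n a (s≤s z≤n)
∈-upFrom⁻ {a} {suc n} {k} (there k∈) with ∈-upFrom⁻ k∈
... | a<k , k< = <⇒≤ a<k , subst (k <_) (sym (+-suc a n)) k<

∈-upFrom⁺ : ∀ {a n k} → a ≤ k → k < a + n → k ∈ upFrom a n
∈-upFrom⁺ {a} {zero} {k} a≤k k<a+0 = ⊥-elim (<⇒≱ k<a+0 (subst (_≤ k) (sym (+-identityʳ a)) a≤k))
∈-upFrom⁺ {a} {suc n} {k} a≤k k< with m≤n⇒m<n∨m≡n a≤k
... | inj₂ refl = here refl
... | inj₁ a<k = there (∈-upFrom⁺ a<k (subst (k <_) (+-suc a n) k<))

∈-interior⁻ : ∀ {i j k} → k ∈ interior (i , j) → i < k × k < j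
∈-interior⁻ {i} {j} {k} k∈ with ∈-upFrom⁻ k∈ | suc i ≤? j
... | i<k , k< | yes i<j = i<k , subst (k <_) (m+[n∸m]≡n i<j) k<
... | i<k , k< | no i≮j = ⊥-elim (<⇒≱ k< (subst (_≤ k) (sym (trans (cong (suc i +_) (m≤n⇒m∸n≡0 (≰⇒≥ i≮j))) (+-identityʳ _))) i<k))

∈-interior⁺ : ∀ {i j k} → i < k → k < j → k ∈ interior (i , j)
∈-interior⁺ {k = k} i<k k<j = ∈-upFrom⁺ i<k (subst (k <_) (sym (m+[n∸m]≡n (<-≤-trans i<k (<⇒≤ k<j)))) k<j)

interior-nonEmpty : ∀ {i j} → 2 + i ≤ j → NonEmpty (interior (i , j))
interior-nonEmpty {i} {j} i+2≤j with j ∸ suc i | m<n⇒0<n∸m i+2≤j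
... | suc _ | _ = refl

-- Counting

count : ∀ {P : ℕ → Set} → Decidable P → ℕ → ℕ → ℕ
count P? a n = length (filter P? (upFrom a n))

upFrom-suc : ∀ a n → upFrom a (suc n) ≡ upFrom a n ++ (a + n) ∷ []
upFrom-suc a zero = cong (λ x → x ∷ []) (sym (+-identityʳ a))
upFrom-suc a (suc n) = cong (a ∷_) (trans (upFrom-suc (suc a) n) (cong (λ x → upFrom (suc a) n ++ x ∷ []) (sym (+-suc a n))))

count-suc : ∀ {P : ℕ → Set} (P? : Decidable P) a n →
            count P? a (suc n) ≡ count P? a n + length (filter P? ((a + n) ∷ []))
count-suc P? a n = begin
  length (filter P? (upFrom a (suc n)))                          ≡⟨ cong (length ∘ filter P?) (upFrom-suc a n) ⟩
  length (filter P? (upFrom a n ++ (a + n) ∷ []))                ≡⟨ cong length (filter-++ P? (upFrom a n) _) ⟩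
  length (filter P? (upFrom a n) ++ filter P? ((a + n) ∷ []))    ≡⟨ length-++ (filter P? (upFrom a n)) ⟩
  count P? a n + length (filter P? ((a + n) ∷ []))               ∎
  where open ≡-Reasoning

-- A strictly increasing list is determined by its set of members, so its length is a count.
sorted-length : ∀ {P : ℕ → Set} (P? : Decidable P) a n xs → Linked _<_ xs →
                (∀ i → i ∈ xs ⇔ (a ≤ i × i < a + n × P i)) → length xs ≡ count P? a n
sorted-length P? a zero [] _ _ = refl
sorted-length P? a zero (x ∷ xs) _ members with Equivalence.to (members x) (here refl)
... | a≤x , x<a+0 , _ = ⊥-elim (<⇒≱ x<a+0 (subst (_≤ x) (sym (+-identityʳ a)) a≤x))
sorted-length {P} P? a (suc n) xs sorted members with P? a
... | no ¬Pa = sorted-length P? (suc a) n xs sorted members′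
  where
  members′ : ∀ i → i ∈ xs ⇔ (suc a ≤ i × i < suc a + n × P i)
  members′ i = mk⇔
    (λ i∈ → let (a≤i , i< , Pi) = Equivalence.to (members i) i∈
            in ≤∧≢⇒< a≤i (λ { refl → ¬Pa Pi }) , subst (i <_) (+-suc a n) i< , Pi)
    (λ (a<i , i< , Pi) → Equivalence.from (members i) (<⇒≤ a<i , subst (i <_) (sym (+-suc a n)) i< , Pi))
sorted-length P? a (suc n) [] _ members | yes Pa with Equivalence.from (members a) (≤-refl , m<m+n a (s≤s z≤n) , Pa)
... | ()
sorted-length {P} P? a (suc n) (x ∷ xs′) sorted members | yes Pa =
  cong suc (sorted-length P? (suc a) n xs′ (Linked.tail sorted) members′)
  where
  a∈xs : a ∈ x ∷ xs′
  a∈xs = Equivalence.from (members a) (≤-refl , m<m+n a (s≤s z≤n) , Pa)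
  above : All (x <_) xs′
  above = AllPairs.head (Linked⇒AllPairs <-trans sorted)
  x≡a : x ≡ a
  x≡a = case a∈xs of λ
    { (here a≡x) → sym a≡x
    ; (there a∈xs′) → ⊥-elim (<⇒≱ (All.lookup above a∈xs′) (proj₁ (Equivalence.to (members x) (here refl)))) }
  members′ : ∀ i → i ∈ xs′ ⇔ (suc a ≤ i × i < suc a + n × P i)
  members′ i = mk⇔
    (λ i∈ → let (_ , i< , Pi) = Equivalence.to (members i) (there i∈)
            in subst (_< i) x≡a (All.lookup above i∈) , subst (i <_) (+-suc a n) i< , Pi)
    (λ (a<i , i< , Pi) → case Equivalence.from (members i) (<⇒≤ a<i , subst (i <_) (sym (+-suc a n)) i< , Pi) of λ
      { (here i≡x) → ⊥-elim (<-irrefl (sym (trans i≡x x≡a)) a<i) ; (there i∈) → i∈ })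

sumBelow : ℕ → (ℕ → ℕ) → ℕ
sumBelow zero f = 0
sumBelow (suc N) f = f 0 + sumBelow N (f ∘ suc)

sumBelow-cong : ∀ N {f g} → (∀ {p} → p < N → f p ≡ g p) → sumBelow N f ≡ sumBelow N g
sumBelow-cong zero f≗g = refl
sumBelow-cong (suc N) f≗g = cong₂ _+_ (f≗g (s≤s z≤n)) (sumBelow-cong N (f≗g ∘ s≤s))

sumBelow-update : ∀ N {f g z δ} → z < N → (∀ {p} → p ≢ z → g p ≡ f p) → g z ≡ f z + δ → sumBelow N g ≡ sumBelow N f + δ
sumBelow-update (suc N) {f} {g} {zero} {δ} _ elsewhere at-z = begin
  g 0 + sumBelow N (g ∘ suc)     ≡⟨ cong₂ _+_ at-z (sumBelow-cong N (λ _ → elsewhere (λ ()))) ⟩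
  f 0 + δ + sumBelow N (f ∘ suc) ≡⟨ +-assoc (f 0) δ _ ⟩
  f 0 + (δ + sumBelow N (f ∘ suc)) ≡⟨ cong (f 0 +_) (+-comm δ _) ⟩
  f 0 + (sumBelow N (f ∘ suc) + δ) ≡⟨ +-assoc (f 0) _ δ ⟨
  f 0 + sumBelow N (f ∘ suc) + δ ∎
  where open ≡-Reasoning
sumBelow-update (suc N) {f} {g} {suc z} {δ} (s≤s z<N) elsewhere at-z =
  trans (cong₂ _+_ (elsewhere (λ ())) (sumBelow-update N z<N (elsewhere ∘ (_∘ suc-injective)) at-z)) (sym (+-assoc (f 0) _ δ))

sumBelow-zero : ∀ N → sumBelow N (λ _ → 0) ≡ 0
sumBelow-zero zero = refl
sumBelow-zero (suc N) = sumBelow-zero N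

occurrences : ℕ → List ℕ → ℕ
occurrences p xs = length (filter (_≟ p) xs)

occurrences-++ : ∀ p xs ys → occurrences p (xs ++ ys) ≡ occurrences p xs + occurrences p ys
occurrences-++ p xs ys = trans (cong length (filter-++ (_≟ p) xs ys)) (length-++ (filter (_≟ p) xs))

occurrences-self : ∀ p → occurrences p (p ∷ []) ≡ 1
occurrences-self p = cong length (filter-accept (_≟ p) {xs = []} refl)

occurrences-none : ∀ {p xs} → All (_≢ p) xs → occurrences p xs ≡ 0
occurrences-none p∉ = cong length (filter-none (_≟ _) p∉)

labels-occurrences : ∀ {ζ vs l e} → Labels ζ vs l e → ∀ p → occurrences p l + at e p ≡ at ζ p
labels-occurrences done p = refl
labels-occurrences {ζ} {e = e} (step {i = i} {l = l} (_ , 1≤ζᵢ , _) _ rest) p with i ≟ p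
... | yes refl = begin
  occurrences i (i ∷ l) + at e i  ≡⟨ cong (λ xs → length xs + at e i) (filter-accept (_≟ i) refl) ⟩
  suc (occurrences i l + at e i)  ≡⟨ cong suc (labels-occurrences rest i) ⟩
  suc (at (subAt ζ i) i)          ≡⟨ cong suc (at-subAt-≡ ζ i) ⟩
  suc (at ζ i ∸ 1)                ≡⟨ +-comm 1 _ ⟩
  at ζ i ∸ 1 + 1                  ≡⟨ m∸n+n≡m 1≤ζᵢ ⟩
  at ζ i                          ∎
  where open ≡-Reasoning
... | no i≢p = begin
  occurrences p (i ∷ l) + at e p  ≡⟨ cong (λ xs → length xs + at e p) (filter-reject (_≟ p) i≢p) ⟩
  occurrences p l + at e p        ≡⟨ labels-occurrences rest p ⟩
  at (subAt ζ i) p                ≡⟨ at-subAt-≢ ζ i≢p ⟩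
  at ζ p                          ∎
  where open ≡-Reasoning

removing≥2⇒removingAll : ∀ {x a m} → (x ≡ a ⊎ suc x ≡ a ⊎ x ≡ 0) → x ≡ a ∸ m → 2 ≤ m → m ≤ a → a ≡ m
removing≥2⇒removingAll {a = a} {m} (inj₁ x≡a) refl 2≤m m≤a = ⊥-elim (<-irrefl x≡a (∸-monoʳ-< (<-≤-trans (s≤s z≤n) 2≤m) m≤a))
removing≥2⇒removingAll {a = a} {m} (inj₂ (inj₁ x+1≡a)) refl 2≤m m≤a = ⊥-elim (1+n≰n (subst (2 ≤_) m≡1 2≤m))
  where
  m≡1 : m ≡ 1
  m≡1 = +-cancelˡ-≡ (a ∸ m) m 1 (trans (m∸n+n≡m m≤a) (trans (sym x+1≡a) (+-comm 1 (a ∸ m))))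
removing≥2⇒removingAll (inj₂ (inj₂ x≡0)) refl _ m≤a = ≤-antisym (m∸n≡0⇒m≤n x≡0) m≤a

-- the contribution of position p to d(η) + 2 D(η), for η(p) = e and w(p) = x
weight : ℕ → ℕ → ℕ
weight e x = (if suc e ≡ᵇ x then 1 else 0) + 2 * (if (e ≡ᵇ 0) ∧ (2 ≤ᵇ x) then 1 else 0)

-- c = w(p) - η(p) counts the steps labelled p; normality leaves c ∈ {0, 1, w(p)}.
occurrences⊓2≡weight : ∀ {c e x} → c + e ≡ x → 1 ≤ x → (e ≡ x ⊎ suc e ≡ x ⊎ e ≡ 0) → c ⊓ 2 ≡ weight e x
occurrences⊓2≡weight {zero} {suc e} refl _ _ rewrite ≢⇒≡ᵇ-false {suc e} {e} 1+n≢n = refl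
occurrences⊓2≡weight {1} {zero} refl _ _ = refl
occurrences⊓2≡weight {1} {suc e} refl _ _ rewrite ≡ᵇ-refl e = refl
occurrences⊓2≡weight {suc (suc c)} {e} refl _ (inj₁ e≡x) = ⊥-elim (m≢1+n+m e {suc c} e≡x)
occurrences⊓2≡weight {suc (suc c)} {e} refl _ (inj₂ (inj₁ e+1≡x)) = ⊥-elim (m≢1+n+m e {c} (suc-injective e+1≡x))
occurrences⊓2≡weight {suc (suc c)} {zero} refl _ (inj₂ (inj₂ refl)) rewrite ⊓-zeroʳ c = refl

sumBelow-weight : ∀ es xs → length es ≡ length xs →
                  sumBelow (length xs) (λ p → weight (at es p) (at xs p)) ≡ dCount es xs + 2 * DCount es xs
sumBelow-weight [] [] _ = refl
sumBelow-weight (e ∷ es) (x ∷ xs) |es|≡|xs| =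
  trans (cong (weight e x +_) (sumBelow-weight es xs (suc-injective |es|≡|xs|)))
        (rearrange (if suc e ≡ᵇ x then 1 else 0) (if (e ≡ᵇ 0) ∧ (2 ≤ᵇ x) then 1 else 0) (dCount es xs) (DCount es xs))
  where
  rearrange : ∀ a b c e → (a + 2 * b) + (c + 2 * e) ≡ (a + c) + 2 * (b + e)
  rearrange = solve 4 (λ a b c e → (a :+ con 2 :* b) :+ (c :+ con 2 :* e) := (a :+ c) :+ con 2 :* (b :+ e)) refl
    where open +-*-Solver

-- The weakly decreasing chain

module LabelledChain (u w : Word) (positive : Positive w) (vs : List Word) (l η : List ℕ)
                     (labels : Labels w vs l η) (decreasing : Linked _≥_ l) (normal : Normal u w η) where

  C : List Word
  C = w ∷ vs

  d : ℕ
  d = length l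

  l⟨_⟩ : ℕ → ℕ
  l⟨ k ⟩ = at l k

  η⟨_⟩ : ℕ → List ℕ
  η⟨ k ⟩ = run w (take k l)

  v⟨_⟩ : ℕ → Word
  v⟨ k ⟩ = nz η⟨ k ⟩

  nz-w : nz w ≡ w
  nz-w = nz-positive positive

  nz-η : nz η ≡ u
  nz-η = proj₁ (proj₁ normal)

  length-C : length C ≡ suc d
  length-C = cong suc (labels-length labels)

  C-nth : ∀ {k} → k ≤ d → nth C k ≡ just v⟨ k ⟩
  C-nth {k} k≤d = subst (λ x → nth (x ∷ vs) k ≡ just v⟨ k ⟩) nz-w (labels-nth labels k k≤d)

  η⟨suc⟩ : ∀ {k} → k < d → η⟨ suc k ⟩ ≡ subAt η⟨ k ⟩ l⟨ k ⟩
  η⟨suc⟩ = run-take-suc w l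

  η⟨d⟩ : η⟨ d ⟩ ≡ η
  η⟨d⟩ = trans (cong (run w) (take-all d l ≤-refl)) (labels-end labels)

  valid : ∀ {k} → k < d → ValidStep η⟨ k ⟩ l⟨ k ⟩
  valid = labels-valid labels _

  length-η⟨⟩ : ∀ k → length η⟨ k ⟩ ≡ length w
  length-η⟨⟩ k = length-run w (take k l)

  l⟨⟩<length : ∀ {k} → k < d → l⟨ k ⟩ < length w
  l⟨⟩<length {k} k<d = subst (l⟨ k ⟩ <_) (length-η⟨⟩ k) (proj₁ (valid k<d))

  l⟨⟩-antitone : ∀ {a b} → a ≤ b → b < d → l⟨ b ⟩ ≤ l⟨ a ⟩
  l⟨⟩-antitone = linked≥-antitone decreasing

  η⟨⟩-antitone : ∀ {a b} → a ≤ b → Pointwise _≤_ η⟨ b ⟩ η⟨ a ⟩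
  η⟨⟩-antitone = run-take-antitone w l

  take-η⟨⟩ : ∀ {k p} → (∀ n → n < k → n < d → p ≤ l⟨ n ⟩) → take p η⟨ k ⟩ ≡ take p w
  take-η⟨⟩ {k} above = take-run w (take k l) (All-take l k above)

  -- Follow C to v_s, take the detour to v_e, then follow the rest of C transferred to the new
  -- expansion of v_e.
  detour⇒skipped : ∀ {s e} → 2 + s ≤ e → e ≤ d → Detour η⟨ s ⟩ v⟨ e ⟩ l⟨ s ⟩ → Skipped u w C (s , e)
  detour⇒skipped {s} {e} s+2≤e e≤d (detour {mids} {q} {lm} path reaches q<) with labels-transfer (sym reaches) (labels-drop e labels)
  ... | l″ , η″ , tail , nz-η″ = s+2≤e , subst (e <_) (sym length-C) (s≤s e≤d) , w ∷ vs′ , (maxChain , _ , l , η″ , η , labels′ , labels , smaller) , outside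
    where
    s<d : s < d
    s<d = ≤-trans (≤-trans (n≤1+n _) s+2≤e) e≤d
    vs′ : List Word
    vs′ = take s vs ++ ((mids ++ v⟨ e ⟩ ∷ []) ++ drop e vs)
    labels′ : Labels w vs′ (take s l ++ ((q ∷ lm) ++ l″)) η″
    labels′ = labels-++ (labels-take s labels) (labels-++ path tail)
    maxChain : MaxChain u w (w ∷ vs′)
    maxChain = subst (λ x → CoverChain (x ∷ vs′)) nz-w (labels-coverChain labels′) , refl ,
               trans (subst (λ x → lastM (x ∷ vs′) ≡ just (nz η″)) nz-w (labels-last labels′)) (cong just (trans nz-η″ nz-η))
    smaller : (take s l ++ ((q ∷ lm) ++ l″)) <lex l
    smaller = subst ((take s l ++ ((q ∷ lm) ++ l″)) <lex_) (sym (split-at l s s<d)) (<lex-++ (take s l) q<)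
    kept : ∀ {k} → k ≤ d → (k ≤ s ⊎ e ≤ k) → v⟨ k ⟩ ∈ (w ∷ vs′)
    kept {zero} _ _ = here nz-w
    kept {suc k} k<d (inj₁ k<s) = there (∈-++⁺ˡ (nth⇒∈take vs (C-nth k<d) k<s))
    kept {k} k≤d (inj₂ e≤k) with m≤n⇒m<n∨m≡n e≤k
    ... | inj₂ refl = there (∈-++⁺ʳ (take s vs) (∈-++⁺ˡ (∈-++⁺ʳ mids (here refl))))
    kept {suc k} k≤d (inj₂ _) | inj₁ (s≤s e≤k) =
      there (∈-++⁺ʳ (take s vs) (∈-++⁺ʳ (mids ++ v⟨ e ⟩ ∷ []) (nth⇒∈drop vs (C-nth k≤d) e≤k)))
    outside : ∀ k → k < length C → (k ≤ s ⊎ e ≤ k) → Σ Word λ v → nth C k ≡ just v × v ∈ (w ∷ vs′)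
    outside k k<C side = v⟨ k ⟩ , C-nth k≤d , kept k≤d side
      where
      k≤d : k ≤ d
      k≤d = s≤s⁻¹ (subst (k <_) length-C k<C)

  -- Swapping the two steps of a descent gives a smaller chain.
  descent⇒skipped : ∀ {i} → 2 + i ≤ d → l⟨ i ⟩ ≢ l⟨ suc i ⟩ → Skipped u w C (i , 2 + i)
  descent⇒skipped {i} i+2≤d p≢q =
    detour⇒skipped ≤-refl i+2≤d (detour {mids = nz ζ ∷ []} (step valid-q refl (step valid-i′ reaches done)) reaches q<p)
    where
    p q : ℕ
    p = l⟨ i ⟩
    q = l⟨ suc i ⟩
    i<d : i < d
    i<d = <-trans (n<1+n i) i+2≤d
    q<p : q < p
    q<p = ≤∧≢⇒< (l⟨⟩-antitone (n≤1+n i) i+2≤d) (p≢q ∘ sym)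
    valid-q : ValidStep η⟨ i ⟩ q
    valid-q = validStep-subAt (subst (λ ζ → ValidStep ζ q) (η⟨suc⟩ i<d) (valid i+2≤d)) q<p
    ζ : List ℕ
    ζ = subAt η⟨ i ⟩ q
    realised : ∃[ i′ ] ValidStep ζ i′ × nz (subAt ζ i′) ≡ nz (subAt ζ p)
    realised = validStep-realises ζ p (subst (1 ≤_) (sym (at-subAt-≢ η⟨ i ⟩ (p≢q ∘ sym))) (proj₁ (proj₂ (valid i<d))))
    i′ : ℕ
    i′ = proj₁ realised
    valid-i′ : ValidStep ζ i′
    valid-i′ = proj₁ (proj₂ realised)
    reaches : nz (subAt ζ i′) ≡ v⟨ 2 + i ⟩
    reaches = begin
      nz (subAt ζ i′)                ≡⟨ proj₂ (proj₂ realised) ⟩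
      nz (subAt (subAt η⟨ i ⟩ q) p)  ≡⟨ cong nz (subAt-comm η⟨ i ⟩ q p) ⟩
      nz (subAt (subAt η⟨ i ⟩ p) q)  ≡⟨ cong (λ ζ → nz (subAt ζ q)) (η⟨suc⟩ i<d) ⟨
      nz (subAt η⟨ suc i ⟩ q)        ≡⟨ cong nz (η⟨suc⟩ i+2≤d) ⟨
      v⟨ 2 + i ⟩                     ∎
      where open ≡-Reasoning

  Constant : ℕ → ℕ → ℕ → Set
  Constant p i j = ∀ k → i ≤ k → k < j → l⟨ k ⟩ ≡ p

  data Boundary : ℕ → Set where
    start  : Boundary 0
    end    : ∀ {k} → d ≤ k → Boundary k
    change : ∀ {k} → l⟨ k ⟩ ≢ l⟨ suc k ⟩ → Boundary (suc k)

  boundary⇒earlier> : ∀ {s n} → Boundary s → s < d → n < s → l⟨ s ⟩ < l⟨ n ⟩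
  boundary⇒earlier> (end d≤s) s<d _ = ⊥-elim (<⇒≱ s<d d≤s)
  boundary⇒earlier> {suc s} (change ne) s+1<d (s≤s n≤s) =
    <-≤-trans (≤∧≢⇒< (l⟨⟩-antitone (n≤1+n s) s+1<d) (ne ∘ sym)) (l⟨⟩-antitone n≤s (<-trans (n<1+n s) s+1<d))

  boundary⇒later< : ∀ {p k e n} → Boundary e → k < e → Constant p k e → e ≤ n → n < d → l⟨ n ⟩ < p
  boundary⇒later< start () _ _ _
  boundary⇒later< (end d≤e) _ _ e≤n n<d = ⊥-elim (<⇒≱ n<d (≤-trans d≤e e≤n))
  boundary⇒later< {e = suc e} (change ne) k<e const e<n n<d =
    subst (l⟨ _ ⟩ <_) (const e (s≤s⁻¹ k<e) (n<1+n e))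
      (≤-<-trans (l⟨⟩-antitone e<n n<d) (≤∧≢⇒< (l⟨⟩-antitone (n≤1+n e) (≤-<-trans e<n n<d)) (ne ∘ sym)))

  η⟨⟩-split : ∀ {k} → k < d → η⟨ k ⟩ ≡ take l⟨ k ⟩ w ++ at η⟨ k ⟩ l⟨ k ⟩ ∷ drop (suc l⟨ k ⟩) η⟨ k ⟩
  η⟨⟩-split {k} k<d = trans (split-at η⟨ k ⟩ l⟨ k ⟩ (proj₁ (valid k<d)))
    (cong (_++ at η⟨ k ⟩ l⟨ k ⟩ ∷ drop (suc l⟨ k ⟩) η⟨ k ⟩) (take-η⟨⟩ (λ n n<k _ → l⟨⟩-antitone (<⇒≤ n<k) k<d)))

  η⟨⟩-alongRun : ∀ {k} n → k < d → k + n ≤ d → Constant l⟨ k ⟩ k (k + n) →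
                 η⟨ k + n ⟩ ≡ take l⟨ k ⟩ w ++ (at η⟨ k ⟩ l⟨ k ⟩ ∸ n) ∷ drop (suc l⟨ k ⟩) η⟨ k ⟩
  η⟨⟩-alongRun {k} zero k<d _ _ = trans (cong η⟨_⟩ (+-identityʳ k)) (η⟨⟩-split k<d)
  η⟨⟩-alongRun {k} (suc n) k<d k+n<d const = begin
    η⟨ k + suc n ⟩                  ≡⟨ cong η⟨_⟩ (+-suc k n) ⟩
    η⟨ suc (k + n) ⟩                ≡⟨ η⟨suc⟩ k+n<d′ ⟩
    subAt η⟨ k + n ⟩ l⟨ k + n ⟩     ≡⟨ cong₂ subAt previous (const (k + n) (m≤m+n k n) (+-monoʳ-< k (n<1+n n))) ⟩
    subAt (P ++ (t ∸ n) ∷ R) p      ≡⟨ cong (subAt (P ++ (t ∸ n) ∷ R)) length-P ⟨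
    subAt (P ++ (t ∸ n) ∷ R) (length P) ≡⟨ subAt-++-length P (t ∸ n) R ⟩
    P ++ (t ∸ n ∸ 1) ∷ R            ≡⟨ cong (λ x → P ++ x ∷ R) (trans (∸-+-assoc t n 1) (cong (t ∸_) (+-comm n 1))) ⟩
    P ++ (t ∸ suc n) ∷ R            ∎
    where
    open ≡-Reasoning
    p t : ℕ
    p = l⟨ k ⟩
    t = at η⟨ k ⟩ p
    P R : List ℕ
    P = take p w
    R = drop (suc p) η⟨ k ⟩
    length-P : length P ≡ p
    length-P = length-take≤ p w (<⇒≤ (l⟨⟩<length k<d))
    k+n<d′ : k + n < d
    k+n<d′ = subst (_≤ d) (+-suc k n) k+n<d
    previous : η⟨ k + n ⟩ ≡ P ++ (t ∸ n) ∷ R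
    previous = η⟨⟩-alongRun n k<d (<⇒≤ k+n<d′) (λ j k≤j j<k+n → const j k≤j (<-trans j<k+n (+-monoʳ-< k (n<1+n n))))

  η⟨⟩-acrossRun : ∀ {k j} → k ≤ j → j ≤ d → k < d → Constant l⟨ k ⟩ k j →
                  η⟨ j ⟩ ≡ take l⟨ k ⟩ w ++ (at η⟨ k ⟩ l⟨ k ⟩ ∸ (j ∸ k)) ∷ drop (suc l⟨ k ⟩) η⟨ k ⟩
  η⟨⟩-acrossRun {k} {j} k≤j j≤d k<d const =
    subst (λ m → η⟨ m ⟩ ≡ take l⟨ k ⟩ w ++ (at η⟨ k ⟩ l⟨ k ⟩ ∸ (j ∸ k)) ∷ drop (suc l⟨ k ⟩) η⟨ k ⟩) k+[j-k]≡j
      (η⟨⟩-alongRun (j ∸ k) k<d (subst (_≤ d) (sym k+[j-k]≡j) j≤d) (λ m k≤m m< → const m k≤m (subst (m <_) k+[j-k]≡j m<)))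
    where
    k+[j-k]≡j : k + (j ∸ k) ≡ j
    k+[j-k]≡j = m+[n∸m]≡n k≤j

  at-η⟨⟩-acrossRun : ∀ {k j} → k ≤ j → j ≤ d → k < d → Constant l⟨ k ⟩ k j → at η⟨ j ⟩ l⟨ k ⟩ ≡ at η⟨ k ⟩ l⟨ k ⟩ ∸ (j ∸ k)
  at-η⟨⟩-acrossRun {k} k≤j j≤d k<d const = trans (cong (λ ζ → at ζ l⟨ k ⟩) (η⟨⟩-acrossRun k≤j j≤d k<d const))
    (at-++-≡ (take l⟨ k ⟩ w) _ (length-take≤ l⟨ k ⟩ w (<⇒≤ (l⟨⟩<length k<d))))

  runLength≤entry : ∀ {k j} → k < j → j ≤ d → Constant l⟨ k ⟩ k j → j ∸ k ≤ at η⟨ k ⟩ l⟨ k ⟩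
  runLength≤entry {k} {suc j} (s≤s k≤j) j<d const = subst (_≤ at η⟨ k ⟩ l⟨ k ⟩) (sym (+-∸-assoc 1 k≤j))
    (m∸n≢0⇒n<m λ used-up → 1+n≰n (begin
      1                             ≤⟨ proj₁ (proj₂ (valid j<d)) ⟩
      at η⟨ j ⟩ l⟨ j ⟩              ≡⟨ cong (at η⟨ j ⟩) (const j k≤j (n<1+n j)) ⟩
      at η⟨ j ⟩ l⟨ k ⟩              ≡⟨ at-η⟨⟩-acrossRun k≤j (<⇒≤ j<d) (<-≤-trans (s≤s k≤j) j<d) (λ m k≤m m<j → const m k≤m (<-trans m<j (n<1+n j))) ⟩
      at η⟨ k ⟩ l⟨ k ⟩ ∸ (j ∸ k)    ≡⟨ used-up ⟩
      0                             ∎))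
    where open ≤-Reasoning

  boundary⇒untouched : ∀ {s} → Boundary s → s < d → at η⟨ s ⟩ l⟨ s ⟩ ≡ at w l⟨ s ⟩
  boundary⇒untouched {s} bs s<d = begin
    at η⟨ s ⟩ p                 ≡⟨ at-take (suc p) η⟨ s ⟩ (n<1+n p) ⟨
    at (take (suc p) η⟨ s ⟩) p  ≡⟨ cong (λ ζ → at ζ p) (take-η⟨⟩ (λ n n<s _ → boundary⇒earlier> bs s<d n<s)) ⟩
    at (take (suc p) w) p       ≡⟨ at-take (suc p) w (n<1+n p) ⟩
    at w p                      ∎
    where
    open ≡-Reasoning
    p : ℕ
    p = l⟨ s ⟩

  at-η⟨⟩-stable : ∀ {a r} o → a + o ≤ d → (∀ n → a ≤ n → n < a + o → l⟨ n ⟩ ≢ r) → at η⟨ a + o ⟩ r ≡ at η⟨ a ⟩ r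
  at-η⟨⟩-stable {a} {r} zero _ _ = cong (λ k → at η⟨ k ⟩ r) (+-identityʳ a)
  at-η⟨⟩-stable {a} {r} (suc o) a+o<d avoid = begin
    at η⟨ a + suc o ⟩ r                 ≡⟨ cong (λ k → at η⟨ k ⟩ r) (+-suc a o) ⟩
    at η⟨ suc (a + o) ⟩ r               ≡⟨ cong (λ ζ → at ζ r) (η⟨suc⟩ a+o<d′) ⟩
    at (subAt η⟨ a + o ⟩ l⟨ a + o ⟩) r  ≡⟨ at-subAt-≢ η⟨ a + o ⟩ (avoid (a + o) (m≤m+n a o) a+o<a+o+1) ⟩
    at η⟨ a + o ⟩ r                     ≡⟨ at-η⟨⟩-stable o (<⇒≤ a+o<d′) (λ n a≤n n< → avoid n a≤n (<-trans n< a+o<a+o+1)) ⟩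
    at η⟨ a ⟩ r                         ∎
    where
    open ≡-Reasoning
    a+o<a+o+1 : a + o < a + suc o
    a+o<a+o+1 = +-monoʳ-< a (n<1+n o)
    a+o<d′ : a + o < d
    a+o<d′ = subst (_≤ d) (+-suc a o) a+o<d

  boundary⇒final : ∀ {p s e} → Boundary e → s < e → e ≤ d → Constant p s e → at η p ≡ at η⟨ e ⟩ p
  boundary⇒final {p} {s} {e} be s<e e≤d const = begin
    at η p                  ≡⟨ cong (λ ζ → at ζ p) η⟨d⟩ ⟨
    at η⟨ d ⟩ p             ≡⟨ cong (λ k → at η⟨ k ⟩ p) e+[d-e]≡d ⟨
    at η⟨ e + (d ∸ e) ⟩ p   ≡⟨ at-η⟨⟩-stable (d ∸ e) (≤-reflexive e+[d-e]≡d) later ⟩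
    at η⟨ e ⟩ p             ∎
    where
    open ≡-Reasoning
    e+[d-e]≡d : e + (d ∸ e) ≡ d
    e+[d-e]≡d = m+[n∸m]≡n e≤d
    later : ∀ n → e ≤ n → n < e + (d ∸ e) → l⟨ n ⟩ ≢ p
    later n e≤n n< = <⇒≢ (boundary⇒later< be s<e const e≤n (subst (n <_) e+[d-e]≡d n<))

  normal-values : ∀ {p} → p < length w → at η p ≡ at w p ⊎ suc (at η p) ≡ at w p ⊎ at η p ≡ 0
  normal-values = proj₁ (proj₂ normal) _

  normal-emptied : ∀ {p} → p < length w → 2 ≤ at w p → at η p ≡ 0 → ∃[ Q ] take p w ≡ Q ++ at w p ∷ [] × suc (length Q) ≡ p
  normal-emptied {zero} p<w 2≤ η≡0 = ⊥-elim (proj₂ (proj₂ (proj₂ normal)) zero p<w 2≤ (λ _ ()) η≡0)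
  normal-emptied {suc r} p<w 2≤ η≡0 with at w r ≟ at w (suc r)
  ... | yes same = take r w , trans (take-suc-at w r (<-trans (n<1+n r) p<w)) (cong (λ x → take r w ++ x ∷ []) same) ,
                   cong suc (length-take≤ r w (<⇒≤ (<-trans (n<1+n r) p<w)))
  ... | no differ = ⊥-elim (proj₂ (proj₂ (proj₂ normal)) (suc r) p<w 2≤ (λ { r′ refl → differ }) η≡0)

  -- η(p) = w(p) - (e - s) with e - s ≥ 2, so normality forces η(p) = 0.
  longRun-exhausts : ∀ {s e} → 2 + s ≤ e → e ≤ d → Boundary s → Boundary e → Constant l⟨ s ⟩ s e →
                     at w l⟨ s ⟩ ≡ e ∸ s
  longRun-exhausts {s} {e} s+2≤e e≤d bs be const =
    removing≥2⇒removingAll (normal-values (l⟨⟩<length s<d)) η-p 2≤m (subst (e ∸ s ≤_) (boundary⇒untouched bs s<d) (runLength≤entry s<e e≤d const))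
    where
    s<e : s < e
    s<e = <-trans (n<1+n s) s+2≤e
    s<d : s < d
    s<d = <-≤-trans s<e e≤d
    2≤m : 2 ≤ e ∸ s
    2≤m = subst (_≤ e ∸ s) (m+n∸n≡m 2 s) (∸-monoˡ-≤ s s+2≤e)
    η-p : at η l⟨ s ⟩ ≡ at w l⟨ s ⟩ ∸ (e ∸ s)
    η-p = trans (boundary⇒final be s<e e≤d const)
                (trans (at-η⟨⟩-acrossRun (<⇒≤ s<e) e≤d s<d const) (cong (_∸ (e ∸ s)) (boundary⇒untouched bs s<d)))

  longRun-end : ∀ {s e} → 2 + s ≤ e → e ≤ d → Boundary s → Boundary e → Constant l⟨ s ⟩ s e →
                η⟨ e ⟩ ≡ take l⟨ s ⟩ w ++ 0 ∷ drop (suc l⟨ s ⟩) η⟨ s ⟩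
  longRun-end {s} {e} s+2≤e e≤d bs be const = trans (η⟨⟩-acrossRun (<⇒≤ s<e) e≤d s<d const)
    (cong (λ x → take l⟨ s ⟩ w ++ x ∷ drop (suc l⟨ s ⟩) η⟨ s ⟩)
          (trans (cong (_∸ (e ∸ s)) (trans (boundary⇒untouched bs s<d) (longRun-exhausts s+2≤e e≤d bs be const))) (n∸n≡0 (e ∸ s))))
    where
    s<e : s < e
    s<e = <-trans (n<1+n s) s+2≤e
    s<d : s < d
    s<d = <-≤-trans s<e e≤d

  -- By normality p is not the first position of its run of w(p)'s, so the whole run
  -- can be replaced by decrementing position p - 1 instead, which gives a smaller chain.
  longRun⇒skipped : ∀ {s e} → 2 + s ≤ e → e ≤ d → Boundary s → Boundary e → Constant l⟨ s ⟩ s e → Skipped u w C (s , e)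
  longRun⇒skipped {s} {e} s+2≤e e≤d bs be const =
    detour⇒skipped s+2≤e e≤d (subst₂ (λ ζ v → Detour ζ v l⟨ s ⟩) (sym shape-s) (sym v⟨e⟩) (emptyFirstOfPair Q n R Q<p))
    where
    p a : ℕ
    p = l⟨ s ⟩
    a = at w p
    R : List ℕ
    R = drop (suc p) η⟨ s ⟩
    s<e : s < e
    s<e = <-trans (n<1+n s) s+2≤e
    s<d : s < d
    s<d = <-≤-trans s<e e≤d
    a≡m : a ≡ e ∸ s
    a≡m = longRun-exhausts s+2≤e e≤d bs be const
    2≤a : 2 ≤ a
    2≤a = subst (2 ≤_) (sym a≡m) (subst (_≤ e ∸ s) (m+n∸n≡m 2 s) (∸-monoˡ-≤ s s+2≤e))
    n : ℕ
    n = a ∸ 2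
    a≡n+2 : a ≡ suc (suc n)
    a≡n+2 = sym (m+[n∸m]≡n 2≤a)
    shape-e : η⟨ e ⟩ ≡ take p w ++ 0 ∷ R
    shape-e = longRun-end s+2≤e e≤d bs be const
    emptied : ∃[ Q ] take p w ≡ Q ++ a ∷ [] × suc (length Q) ≡ p
    emptied = normal-emptied (l⟨⟩<length s<d) 2≤a
      (trans (boundary⇒final be s<e e≤d const) (trans (cong (λ ζ → at ζ p) shape-e) (at-++-≡ (take p w) R (length-take≤ p w (<⇒≤ (l⟨⟩<length s<d))))))
    Q : List ℕ
    Q = proj₁ emptied
    Q<p : length Q < p
    Q<p = ≤-reflexive (proj₂ (proj₂ emptied))
    shape-s : η⟨ s ⟩ ≡ Q ++ suc (suc n) ∷ suc (suc n) ∷ R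
    shape-s = begin
      η⟨ s ⟩                        ≡⟨ η⟨⟩-split s<d ⟩
      take p w ++ at η⟨ s ⟩ p ∷ R   ≡⟨ cong₂ (λ P x → P ++ x ∷ R) (proj₁ (proj₂ emptied)) (boundary⇒untouched bs s<d) ⟩
      (Q ++ a ∷ []) ++ a ∷ R        ≡⟨ ++-assoc Q (a ∷ []) (a ∷ R) ⟩
      Q ++ a ∷ a ∷ R                ≡⟨ cong (λ x → Q ++ x ∷ x ∷ R) a≡n+2 ⟩
      Q ++ suc (suc n) ∷ suc (suc n) ∷ R ∎
      where open ≡-Reasoning
    v⟨e⟩ : v⟨ e ⟩ ≡ nz (Q ++ suc (suc n) ∷ 0 ∷ R)
    v⟨e⟩ = begin
      nz η⟨ e ⟩                      ≡⟨ cong nz shape-e ⟩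
      nz (take p w ++ 0 ∷ R)         ≡⟨ cong (λ P → nz (P ++ 0 ∷ R)) (proj₁ (proj₂ emptied)) ⟩
      nz ((Q ++ a ∷ []) ++ 0 ∷ R)    ≡⟨ cong nz (++-assoc Q (a ∷ []) (0 ∷ R)) ⟩
      nz (Q ++ a ∷ 0 ∷ R)            ≡⟨ cong (λ x → nz (Q ++ x ∷ 0 ∷ R)) a≡n+2 ⟩
      nz (Q ++ suc (suc n) ∷ 0 ∷ R)  ∎
      where open ≡-Reasoning

  ∈⇒sameStep : ∀ {vs′ l′ η′} → Labels w vs′ l′ η′ → ∀ {m} → m ≤ d → v⟨ m ⟩ ∈ (w ∷ vs′) →
               m ≤ length l′ × nz (run w (take m l′)) ≡ v⟨ m ⟩
  ∈⇒sameStep {vs′} {l′} labels′ {m} m≤d v∈ with ∈⇒nth (w ∷ vs′) v∈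
  ... | k , nth≡ = subst (_≤ length l′) k≡m k≤l′ , subst (λ k → nz (run w (take k l′)) ≡ v⟨ m ⟩) k≡m same
    where
    k≤l′ : k ≤ length l′
    k≤l′ = s≤s⁻¹ (subst (k <_) (cong suc (labels-length labels′)) (nth⇒< (w ∷ vs′) nth≡))
    same : nz (run w (take k l′)) ≡ v⟨ m ⟩
    same = just-injective (trans (sym (subst (λ x → nth (x ∷ vs′) k ≡ just (nz (run w (take k l′)))) nz-w (labels-nth labels′ k k≤l′))) nth≡)
    k≡m : k ≡ m
    k≡m = +-cancelˡ-≡ (sum v⟨ m ⟩) k m (begin
      sum v⟨ m ⟩ + k                    ≡⟨ cong (λ v → sum v + k) same ⟨
      sum (nz (run w (take k l′))) + k  ≡⟨ cong (_+ k) (sum-nz (run w (take k l′))) ⟩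
      sum (run w (take k l′)) + k       ≡⟨ labels-rank labels′ k k≤l′ ⟩
      sum w                             ≡⟨ labels-rank labels m m≤d ⟨
      sum η⟨ m ⟩ + m                    ≡⟨ cong (_+ m) (sum-nz η⟨ m ⟩) ⟨
      sum v⟨ m ⟩ + m                    ∎)
      where open ≡-Reasoning

  -- k is where the label sequences first differ; chains through a word reach it after the same
  -- number of steps, so k cannot lie outside the interval.
  skipped⇒branch : ∀ {i j} → j ≤ d → Skipped u w C (i , j) →
                   ∃[ k ] ∃[ q ] i ≤ k × suc k < j × q < l⟨ k ⟩ × v⟨ j ⟩ ≼ nz (subAt η⟨ k ⟩ q)
  skipped⇒branch j≤d (_ , _ , [] , ((_ , () , _) , _) , _)
  skipped⇒branch {i} {j} j≤d (_ , _ , x ∷ vs′ , ((_ , head , _) , l′ , l₂ , η′ , η₂ , labels′ , labels₂ , smaller) , outside)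
    with just-injective head
  ... | refl = k , q , i≤k , k+1<j , q<p , subst (_≼ nz (subAt η⟨ k ⟩ q)) (proj₂ (agree j≤d (inj₂ ≤-refl))) back
    where
    difference : ∃[ k ] k < length l′ × k < d × take k l′ ≡ take k l × at l′ k < l⟨ k ⟩
    difference = <lex⇒firstDifference (subst (l′ <lex_) (sym (labels-unique labels labels₂)) smaller)
    k q : ℕ
    k = proj₁ difference
    q = at l′ k
    k<l′ : k < length l′
    k<l′ = proj₁ (proj₂ difference)
    k<d : k < d
    k<d = proj₁ (proj₂ (proj₂ difference))
    q<p : q < l⟨ k ⟩
    q<p = proj₂ (proj₂ (proj₂ (proj₂ difference)))
    η′⟨k⟩ : run w (take k l′) ≡ η⟨ k ⟩
    η′⟨k⟩ = cong (run w) (proj₁ (proj₂ (proj₂ (proj₂ difference))))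
    η′⟨k+1⟩ : run w (take (suc k) l′) ≡ subAt η⟨ k ⟩ q
    η′⟨k+1⟩ = trans (run-take-suc w l′ k<l′) (cong (λ ζ → subAt ζ q) η′⟨k⟩)
    agree : ∀ {m} → m ≤ d → (m ≤ i ⊎ j ≤ m) → m ≤ length l′ × nz (run w (take m l′)) ≡ v⟨ m ⟩
    agree {m} m≤d side with outside m (subst (m <_) (sym length-C) (s≤s m≤d)) side
    ... | v , nth≡ , v∈ = ∈⇒sameStep labels′ m≤d (subst (_∈ (w ∷ vs′)) (just-injective (trans (sym nth≡) (C-nth m≤d))) v∈)
    differs : nz (subAt η⟨ k ⟩ q) ≢ v⟨ suc k ⟩
    differs same = <-irrefl (validStep-unique valid-q (valid k<d) (trans same (cong nz (η⟨suc⟩ k<d)))) q<p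
      where
      valid-q : ValidStep η⟨ k ⟩ q
      valid-q = subst (λ ζ → ValidStep ζ q) η′⟨k⟩ (labels-valid labels′ k k<l′)
    i≤k : i ≤ k
    i≤k with suc k ≤? i
    ... | yes k<i = ⊥-elim (differs (trans (cong nz (sym η′⟨k+1⟩)) (proj₂ (agree k<d (inj₁ k<i)))))
    ... | no k≮i = s≤s⁻¹ (≰⇒> k≮i)
    k+1<j : suc k < j
    k+1<j with j ≤? suc k
    ... | yes j≤k+1 = ⊥-elim (differs (trans (cong nz (sym η′⟨k+1⟩)) (proj₂ (agree k<d (inj₂ j≤k+1)))))
    ... | no j≰k+1 = ≰⇒> j≰k+1
    back : nz (run w (take j l′)) ≼ nz (subAt η⟨ k ⟩ q)
    back = subst (λ ζ → nz (run w (take j l′)) ≼ nz ζ) η′⟨k+1⟩ (pointwise⇒nz≼ (run-take-antitone w l′ (<⇒≤ k+1<j)))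

  ¬boundary⇒continues : ∀ {i} → ¬ Boundary i → ∃[ i₀ ] i ≡ suc i₀ × l⟨ i₀ ⟩ ≡ l⟨ i ⟩
  ¬boundary⇒continues {zero} ¬b = ⊥-elim (¬b start)
  ¬boundary⇒continues {suc i₀} ¬b with l⟨ i₀ ⟩ ≟ l⟨ suc i₀ ⟩
  ... | yes same = i₀ , refl , same
  ... | no differ = ⊥-elim (¬b (change differ))

  exhausted⇒boundary : ∀ {k j} → k < j → j ≤ d → Constant l⟨ k ⟩ k j → at η⟨ j ⟩ l⟨ k ⟩ ≡ 0 → Boundary j
  exhausted⇒boundary {k} {suc j} k<j j≤d const η⟨j⟩≡0 with suc j <? d
  ... | no j≮d = end (≮⇒≥ j≮d)
  ... | yes j<d = change λ same → 1+n≰n (begin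
    1                          ≤⟨ proj₁ (proj₂ (valid j<d)) ⟩
    at η⟨ suc j ⟩ l⟨ suc j ⟩   ≡⟨ cong (at η⟨ suc j ⟩) (trans (sym same) (const j (s≤s⁻¹ k<j) (n<1+n j))) ⟩
    at η⟨ suc j ⟩ l⟨ k ⟩       ≡⟨ η⟨j⟩≡0 ⟩
    0                          ∎)
    where open ≤-Reasoning

  used⇒below : ∀ {i k} → i < k → i < d → at η⟨ k ⟩ l⟨ i ⟩ < at w l⟨ i ⟩
  used⇒below {i} {k} i<k i<d = begin-strict
    at η⟨ k ⟩ l⟨ i ⟩          ≤⟨ pointwise-at (η⟨⟩-antitone i<k) l⟨ i ⟩ ⟩
    at η⟨ suc i ⟩ l⟨ i ⟩      ≡⟨ cong (λ ζ → at ζ l⟨ i ⟩) (η⟨suc⟩ i<d) ⟩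
    at (subAt η⟨ i ⟩ l⟨ i ⟩) l⟨ i ⟩ ≡⟨ at-subAt-≡ η⟨ i ⟩ l⟨ i ⟩ ⟩
    at η⟨ i ⟩ l⟨ i ⟩ ∸ 1      <⟨ ∸-monoʳ-< (s≤s z≤n) (proj₁ (proj₂ (valid i<d))) ⟩
    at η⟨ i ⟩ l⟨ i ⟩ ∸ 0      ≤⟨ pointwise-at (η⟨⟩-antitone {0} {i} z≤n) l⟨ i ⟩ ⟩
    at w l⟨ i ⟩               ∎
    where open ≤-Reasoning

  branch-shape : ∀ {k q} → k < d → q < l⟨ k ⟩ →
                 nz (subAt η⟨ k ⟩ q) ≡ nz (subAt (take l⟨ k ⟩ w) q) ++ at η⟨ k ⟩ l⟨ k ⟩ ∷ nz (drop (suc l⟨ k ⟩) η⟨ k ⟩)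
  branch-shape {k} {q} k<d q<p = begin
    nz (subAt η⟨ k ⟩ q)            ≡⟨ cong (λ ζ → nz (subAt ζ q)) (η⟨⟩-split k<d) ⟩
    nz (subAt (P ++ t ∷ R) q)      ≡⟨ cong nz (subAt-++ˡ P (t ∷ R) (subst (q <_) (sym (length-take≤ p w (<⇒≤ (l⟨⟩<length k<d)))) q<p)) ⟩
    nz (subAt P q ++ t ∷ R)        ≡⟨ nz-++ (subAt P q) (t ∷ R) ⟩
    nz (subAt P q) ++ nz (t ∷ R)   ≡⟨ cong (nz (subAt P q) ++_) (nz-∷-positive (proj₁ (proj₂ (valid k<d)))) ⟩
    nz (subAt P q) ++ t ∷ nz R     ∎
    where
    open ≡-Reasoning
    p t : ℕ
    p = l⟨ k ⟩
    t = at η⟨ k ⟩ p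
    P R : List ℕ
    P = take p w
    R = drop (suc p) η⟨ k ⟩

  v⟨⟩-acrossRun : ∀ {k j} → k ≤ j → j ≤ d → k < d → Constant l⟨ k ⟩ k j →
                  v⟨ j ⟩ ≡ take l⟨ k ⟩ w ++ nz (at η⟨ j ⟩ l⟨ k ⟩ ∷ drop (suc l⟨ k ⟩) η⟨ k ⟩)
  v⟨⟩-acrossRun {k} {j} k≤j j≤d k<d const = begin
    nz η⟨ j ⟩                                      ≡⟨ cong nz (η⟨⟩-acrossRun k≤j j≤d k<d const) ⟩
    nz (P ++ (at η⟨ k ⟩ p ∸ (j ∸ k)) ∷ R)          ≡⟨ cong (λ x → nz (P ++ x ∷ R)) (at-η⟨⟩-acrossRun k≤j j≤d k<d const) ⟨
    nz (P ++ at η⟨ j ⟩ p ∷ R)                      ≡⟨ nz-++ P (at η⟨ j ⟩ p ∷ R) ⟩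
    nz P ++ nz (at η⟨ j ⟩ p ∷ R)                   ≡⟨ cong (_++ nz (at η⟨ j ⟩ p ∷ R)) (nz-positive (Allₚ.take⁺ p positive)) ⟩
    P ++ nz (at η⟨ j ⟩ p ∷ R)                      ∎
    where
    open ≡-Reasoning
    p : ℕ
    p = l⟨ k ⟩
    P R : List ℕ
    P = take p w
    R = drop (suc p) η⟨ k ⟩

  -- Let η_k = P ++ t ∷ R with P = w(0) ⋯ w(p - 1). If the run leaves η_j(p) > 0, then v_j is too
  -- long to lie below the branch. Otherwise the interval is not a whole run, so p was decremented
  -- before step k, and normality makes the last entry of P equal to w(p) > t.
  ¬branch-inRun : ∀ {i k j q} → i ≤ k → suc k < j → j ≤ d → Constant l⟨ i ⟩ i j → ¬ (Boundary i × Boundary j) →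
                  q < l⟨ k ⟩ → ¬ (v⟨ j ⟩ ≼ nz (subAt η⟨ k ⟩ q))
  ¬branch-inRun {i} {k} {j} {q} i≤k k+1<j j≤d const ¬bounded q<p v≼ = cases (at η⟨ j ⟩ p) refl
    where
    k<j : k < j
    k<j = <-trans (n<1+n k) k+1<j
    k<d : k < d
    k<d = <-≤-trans k<j j≤d
    p t : ℕ
    p = l⟨ k ⟩
    t = at η⟨ k ⟩ p
    P R : List ℕ
    P = take p w
    R = drop (suc p) η⟨ k ⟩
    const-k : Constant p k j
    const-k m k≤m m<j = trans (const m (≤-trans i≤k k≤m) m<j) (sym (const k i≤k k<j))
    length-P : length P ≡ p
    length-P = length-take≤ p w (<⇒≤ (l⟨⟩<length k<d))
    P-positive : Positive P
    P-positive = Allₚ.take⁺ p positive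
    below : ∀ {x} → at η⟨ j ⟩ p ≡ x → (P ++ nz (x ∷ R)) ≼ (nz (subAt P q) ++ t ∷ nz R)
    below {x} eq = subst₂ _≼_ (trans (v⟨⟩-acrossRun (<⇒≤ k<j) j≤d k<d const-k) (cong (λ y → P ++ nz (y ∷ R)) eq))
                              (branch-shape k<d q<p) v≼
    cases : ∀ x → at η⟨ j ⟩ p ≡ x → ⊥
    cases (suc x) eq = ¬≼-decremented P q P-positive (subst (q <_) (sym length-P) q<p) (suc x ∷ nz R) (t ∷ nz R) ≤-refl (below eq)
    cases zero eq = ¬≼-decrementedBefore Q q (subst Positive P≡Q+a P-positive) (s≤s⁻¹ (subst (q <_) (sym 1+|Q|≡p) q<p)) (nz R) t<w
      (subst (λ P′ → (P′ ++ nz R) ≼ (nz (subAt P′ q) ++ t ∷ nz R)) P≡Q+a (below eq))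
      where
      continues : ∃[ i₀ ] i ≡ suc i₀ × l⟨ i₀ ⟩ ≡ l⟨ i ⟩
      continues = ¬boundary⇒continues (λ bi → ¬bounded (bi , exhausted⇒boundary k<j j≤d const-k eq))
      t<w : t < at w p
      t<w with continues
      ... | i₀ , refl , same = subst (λ x → at η⟨ k ⟩ x < at w x) (trans same (sym (const k i≤k k<j))) (used⇒below i≤k (<-trans i≤k k<d))
      η≡0 : at η p ≡ 0
      η≡0 = n≤0⇒n≡0 (subst₂ (λ ζ x → at ζ p ≤ x) η⟨d⟩ eq (pointwise-at (η⟨⟩-antitone j≤d) p))
      emptied : ∃[ Q ] P ≡ Q ++ at w p ∷ [] × suc (length Q) ≡ p
      emptied = normal-emptied (l⟨⟩<length k<d) (<-≤-trans (s≤s (proj₁ (proj₂ (valid k<d)))) t<w) η≡0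
      Q : List ℕ
      Q = proj₁ emptied
      P≡Q+a : P ≡ Q ++ at w p ∷ []
      P≡Q+a = proj₁ (proj₂ emptied)
      1+|Q|≡p : suc (length Q) ≡ p
      1+|Q|≡p = proj₂ (proj₂ emptied)

  insideRun⇒¬skipped : ∀ {i j} → j ≤ d → Constant l⟨ i ⟩ i j → ¬ (Boundary i × Boundary j) → ¬ Skipped u w C (i , j)
  insideRun⇒¬skipped j≤d const ¬bounded sk with skipped⇒branch j≤d sk
  ... | k , q , i≤k , k+1<j , q<p , v≼ = ¬branch-inRun i≤k k+1<j j≤d const ¬bounded q<p v≼

  inside⇒¬boundary : ∀ {p i j m} → Constant p i j → j ≤ d → i < m → m < j → ¬ Boundary m
  inside⇒¬boundary const j≤d () m<j start
  inside⇒¬boundary const j≤d i<m m<j (end d≤m) = <⇒≱ m<j (≤-trans j≤d d≤m)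
  inside⇒¬boundary {m = suc m} const j≤d i<m m<j (change ne) =
    ne (trans (const m (s≤s⁻¹ i<m) (<-trans (n<1+n m) m<j)) (sym (const (suc m) (<⇒≤ i<m) m<j)))

  -- The minimal skipped intervals

  boundary? : ∀ k → Dec (Boundary k)
  boundary? zero = yes start
  boundary? (suc k) with d ≤? suc k | l⟨ k ⟩ ≟ l⟨ suc k ⟩
  ... | yes d≤k | _ = yes (end d≤k)
  ... | no _ | no differ = yes (change differ)
  ... | no d≰k | yes same = no λ { (end d≤k) → d≰k d≤k ; (change differ) → differ same }

  constant-or-descent : ∀ {i j} → i < j → Constant l⟨ i ⟩ i j ⊎ ∃[ k ] i ≤ k × suc k < j × l⟨ k ⟩ ≢ l⟨ suc k ⟩
  constant-or-descent {i} {j} i<j = subst (λ m → Constant l⟨ i ⟩ i m ⊎ ∃[ k ] i ≤ k × suc k < m × l⟨ k ⟩ ≢ l⟨ suc k ⟩)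
    (m+[n∸m]≡n i<j) (go (j ∸ suc i))
    where
    go : ∀ n → Constant l⟨ i ⟩ i (suc i + n) ⊎ ∃[ k ] i ≤ k × suc k < suc i + n × l⟨ k ⟩ ≢ l⟨ suc k ⟩
    go zero = inj₁ λ k i≤k k<i+1 → cong l⟨_⟩ (≤-antisym (subst (k ≤_) (+-identityʳ i) (s≤s⁻¹ k<i+1)) i≤k)
    go (suc n) with go n
    ... | inj₂ (k , i≤k , k+1<i+n+1 , differ) = inj₂ (k , i≤k , <-trans k+1<i+n+1 (s≤s (+-monoʳ-< i (n<1+n n))) , differ)
    ... | inj₁ const with l⟨ i + n ⟩ ≟ l⟨ suc (i + n) ⟩
    ...   | no differ = inj₂ (i + n , m≤m+n i n , s≤s (≤-reflexive (sym (+-suc i n))) , differ)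
    ...   | yes same = inj₁ extended
      where
      extended : Constant l⟨ i ⟩ i (suc i + suc n)
      extended k i≤k k< with m≤n⇒m<n∨m≡n (s≤s⁻¹ (subst (k <_) (cong suc (+-suc i n)) k<))
      ... | inj₁ k<i+n+1 = const k i≤k k<i+n+1
      ... | inj₂ refl = trans (sym same) (const (i + n) (m≤m+n i n) (n<1+n (i + n)))

  boundaryBelow : ∀ k → ∃[ s ] s ≤ k × Boundary s × Constant l⟨ k ⟩ s (suc k)
  boundaryBelow zero = zero , z≤n , start , λ { zero _ _ → refl ; (suc m) _ (s≤s ()) }
  boundaryBelow (suc k) with boundary? (suc k)
  ... | yes b = suc k , ≤-refl , b , λ m k≤m m<k → cong l⟨_⟩ (≤-antisym (s≤s⁻¹ m<k) k≤m)
  ... | no ¬b with ¬boundary⇒continues ¬b | boundaryBelow k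
  ...   | .k , refl , same | s , s≤k , b , const = s , m≤n⇒m≤1+n s≤k , b , extended
    where
    extended : Constant l⟨ suc k ⟩ s (2 + k)
    extended m s≤m m<k+2 with m≤n⇒m<n∨m≡n (s≤s⁻¹ m<k+2)
    ... | inj₁ m<k+1 = trans (const m s≤m m<k+1) same
    ... | inj₂ refl = refl

  boundaryAbove : ∀ f k → suc k + f ≡ d → ∃[ e ] k < e × e ≤ d × Boundary e × Constant l⟨ k ⟩ k e
  boundaryAbove zero k k+1≡d = suc k , ≤-refl , ≤-reflexive (trans (sym (+-identityʳ _)) k+1≡d) ,
    end (≤-reflexive (trans (sym k+1≡d) (+-identityʳ _))) , λ m k≤m m<k+1 → cong l⟨_⟩ (≤-antisym (s≤s⁻¹ m<k+1) k≤m)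
  boundaryAbove (suc f) k k+f≡d with l⟨ k ⟩ ≟ l⟨ suc k ⟩
  ... | no differ = suc k , ≤-refl , subst (suc k ≤_) k+f≡d (m≤m+n (suc k) (suc f)) , change differ ,
    λ m k≤m m<k+1 → cong l⟨_⟩ (≤-antisym (s≤s⁻¹ m<k+1) k≤m)
  ... | yes same with boundaryAbove f (suc k) (trans (sym (+-suc (suc k) f)) k+f≡d)
  ...   | e , k<e , e≤d , b , const = e , <-trans (n<1+n k) k<e , e≤d , b , extended
    where
    extended : Constant l⟨ k ⟩ k e
    extended m k≤m m<e with m≤n⇒m<n∨m≡n k≤m
    ... | inj₁ k<m = trans (const m k<m m<e) (sym same)
    ... | inj₂ refl = refl

  data DescentOrLongRun : ℕ × ℕ → Set where
    descent : ∀ {i} → 2 + i ≤ d → l⟨ i ⟩ ≢ l⟨ suc i ⟩ → DescentOrLongRun (i , 2 + i)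
    longRun : ∀ {i j} → 2 + i ≤ j → j ≤ d → Boundary i → Boundary j → Constant l⟨ i ⟩ i j → DescentOrLongRun (i , j)

  shape⇒skipped : ∀ {I} → DescentOrLongRun I → Skipped u w C I
  shape⇒skipped (descent i+2≤d differ) = descent⇒skipped i+2≤d differ
  shape⇒skipped (longRun i+2≤j j≤d bi bj const) = longRun⇒skipped i+2≤j j≤d bi bj const

  shape⇒MSI : ∀ {i j} → DescentOrLongRun (i , j) → MSI u w C (i , j)
  shape⇒MSI {i} {j} shape = shape⇒skipped shape , minimal shape
    where
    minimal : DescentOrLongRun (i , j) → ∀ i′ j′ → Skipped u w C (i′ , j′) → i ≤ i′ → j′ ≤ j → i ≡ i′ × j ≡ j′
    minimal (descent _ _) i′ j′ (i′+2≤j′ , _) i≤i′ j′≤j =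
      ≤-antisym i≤i′ (+-cancelˡ-≤ 2 i′ i (≤-trans i′+2≤j′ j′≤j)) , ≤-antisym (≤-trans (+-monoʳ-≤ 2 i≤i′) i′+2≤j′) j′≤j
    minimal (longRun _ j≤d _ _ const) i′ j′ sk i≤i′ j′≤j with i ≟ i′ | j ≟ j′
    ... | yes i≡i′ | yes j≡j′ = i≡i′ , j≡j′
    ... | no i≢i′ | _ = ⊥-elim (insideRun⇒¬skipped (≤-trans j′≤j j≤d) const′ (inside⇒¬boundary const j≤d (≤∧≢⇒< i≤i′ i≢i′) i′<j ∘ proj₁) sk)
      where
      i′<j : i′ < j
      i′<j = <-≤-trans (<-trans (n<1+n i′) (proj₁ sk)) j′≤j
      const′ : Constant l⟨ i′ ⟩ i′ j′
      const′ k i′≤k k<j′ = trans (const k (≤-trans i≤i′ i′≤k) (<-≤-trans k<j′ j′≤j)) (sym (const i′ i≤i′ i′<j))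
    ... | yes refl | no j≢j′ = ⊥-elim (insideRun⇒¬skipped (≤-trans j′≤j j≤d) const′ (inside⇒¬boundary const j≤d i<j′ j′<j ∘ proj₂) sk)
      where
      i<j′ : i < j′
      i<j′ = <-trans (n<1+n i) (proj₁ sk)
      j′<j : j′ < j
      j′<j = ≤∧≢⇒< j′≤j (j≢j′ ∘ sym)
      const′ : Constant l⟨ i ⟩ i j′
      const′ k i≤k k<j′ = const k i≤k (<-trans k<j′ j′<j)

  MSI⇒shape : ∀ {i j} → MSI u w C (i , j) → DescentOrLongRun (i , j)
  MSI⇒shape {i} {j} (sk , minimal) = classify (constant-or-descent (<-trans (n<1+n i) i+2≤j))
    where
    i+2≤j : 2 + i ≤ j
    i+2≤j = proj₁ sk
    j≤d : j ≤ d
    j≤d = s≤s⁻¹ (subst (j <_) length-C (proj₁ (proj₂ sk)))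
    classify : Constant l⟨ i ⟩ i j ⊎ (∃[ k ] i ≤ k × suc k < j × l⟨ k ⟩ ≢ l⟨ suc k ⟩) → DescentOrLongRun (i , j)
    classify (inj₂ (k , i≤k , k+1<j , differ)) with minimal k (2 + k) (descent⇒skipped (≤-trans k+1<j j≤d) differ) i≤k k+1<j
    ... | i≡k , j≡k+2 = subst₂ (λ a b → DescentOrLongRun (a , b)) (sym i≡k) (sym j≡k+2) (descent (≤-trans k+1<j j≤d) differ)
    classify (inj₁ const) with boundary? i | boundary? j
    ... | yes bi | yes bj = longRun i+2≤j j≤d bi bj const
    ... | no ¬bi | _ = ⊥-elim (insideRun⇒¬skipped j≤d const (¬bi ∘ proj₁) sk)
    ... | yes _ | no ¬bj = ⊥-elim (insideRun⇒¬skipped j≤d const (¬bj ∘ proj₂) sk)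

  shapes-disjoint : ∀ {I I′ k} → DescentOrLongRun I → DescentOrLongRun I′ → k ∈ interior I → k ∈ interior I′ → I ≡ I′
  shapes-disjoint {I} {I′} {k} shape shape′ k∈I k∈I′ = go shape shape′ (∈-interior⁻ k∈I) (∈-interior⁻ k∈I′)
    where
    just-after : ∀ {i} → i < k → k < 2 + i → k ≡ suc i
    just-after i<k k<i+2 = ≤-antisym (s≤s⁻¹ k<i+2) i<k
    go : DescentOrLongRun I → DescentOrLongRun I′ → proj₁ I < k × k < proj₂ I → proj₁ I′ < k × k < proj₂ I′ → I ≡ I′
    go (descent _ _) (descent _ _) (i<k , k<) (i′<k , k<′) =
      cong (λ i → i , 2 + i) (suc-injective (trans (sym (just-after i<k k<)) (just-after i′<k k<′)))
    go (descent _ differ) (longRun _ _ _ _ const) (i<k , k<) (i′<k , k<j′) with just-after i<k k<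
    ... | refl = ⊥-elim (differ (trans (const _ (s≤s⁻¹ i′<k) (<-trans (n<1+n _) k<j′)) (sym (const k (<⇒≤ i′<k) k<j′))))
    go (longRun _ _ _ _ const) (descent _ differ) (i<k , k<j) (i′<k , k<) with just-after i′<k k<
    ... | refl = ⊥-elim (differ (trans (const _ (s≤s⁻¹ i<k) (<-trans (n<1+n _) k<j)) (sym (const k (<⇒≤ i<k) k<j))))
    go (longRun {i} {j} _ j≤d bi bj const) (longRun {i′} {j′} _ j′≤d bi′ bj′ const′) (i<k , k<j) (i′<k , k<j′) =
      cong₂ _,_ same-start same-end
      where
      same-start : i ≡ i′
      same-start with <-cmp i i′
      ... | tri< i<i′ _ _ = ⊥-elim (inside⇒¬boundary const j≤d i<i′ (<-trans i′<k k<j) bi′)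
      ... | tri≈ _ i≡i′ _ = i≡i′
      ... | tri> _ _ i′<i = ⊥-elim (inside⇒¬boundary const′ j′≤d i′<i (<-trans i<k k<j′) bi)
      same-end : j ≡ j′
      same-end with <-cmp j j′
      ... | tri< j<j′ _ _ = ⊥-elim (inside⇒¬boundary const′ j′≤d (<-trans i′<k k<j) j<j′ bj)
      ... | tri≈ _ j≡j′ _ = j≡j′
      ... | tri> _ _ j′<j = ⊥-elim (inside⇒¬boundary const j≤d (<-trans i<k k<j′) j′<j bj′)

  shape-cover : ∀ {k} → 1 ≤ k → k < d → ∃[ I ] DescentOrLongRun I × k ∈ interior I
  shape-cover {suc k} _ k+1<d with l⟨ k ⟩ ≟ l⟨ suc k ⟩
  ... | no differ = (k , 2 + k) , descent k+1<d differ , ∈-interior⁺ ≤-refl ≤-refl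
  ... | yes same with boundaryBelow k | boundaryAbove (d ∸ suc (suc k)) (suc k) (m+[n∸m]≡n k+1<d)
  ...   | s , s≤k , bs , const-s | e , k+1<e , e≤d , be , const-e =
    (s , e) , longRun (≤-trans (s≤s (s≤s s≤k)) k+1<e) e≤d bs be const , ∈-interior⁺ (s≤s s≤k) k+1<e
    where
    const : Constant l⟨ s ⟩ s e
    const m s≤m m<e with m ≤? k
    ... | yes m≤k = trans (const-s m s≤m (s≤s m≤k)) (sym (const-s s ≤-refl (s≤s s≤k)))
    ... | no m≰k = trans (const-e m (≰⇒> m≰k) m<e) (trans (sym same) (sym (const-s s ≤-refl (s≤s s≤k))))

  LeftEnd : ℕ → Set
  LeftEnd i = l⟨ i ⟩ ≢ l⟨ suc i ⟩ ⊎ Boundary i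

  leftEnd? : Decidable LeftEnd
  leftEnd? i with l⟨ i ⟩ ≟ l⟨ suc i ⟩ | boundary? i
  ... | no differ | _ = yes (inj₁ differ)
  ... | yes _ | yes b = yes (inj₂ b)
  ... | yes same | no ¬b = no [ (λ differ → differ same) , ¬b ]′

  shape⇒leftEnd : ∀ {i j} → DescentOrLongRun (i , j) → 2 + i ≤ d × LeftEnd i
  shape⇒leftEnd (descent i+2≤d differ) = i+2≤d , inj₁ differ
  shape⇒leftEnd (longRun i+2≤j j≤d bi _ _) = ≤-trans i+2≤j j≤d , inj₂ bi

  leftEnd⇒shape : ∀ {i} → 2 + i ≤ d → LeftEnd i → ∃[ j ] DescentOrLongRun (i , j)
  leftEnd⇒shape i+2≤d (inj₁ differ) = _ , descent i+2≤d differ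
  leftEnd⇒shape {i} i+2≤d (inj₂ bi) with l⟨ i ⟩ ≟ l⟨ suc i ⟩
  ... | no differ = _ , descent i+2≤d differ
  ... | yes same with boundaryAbove (d ∸ (2 + i)) (suc i) (m+[n∸m]≡n i+2≤d)
  ...   | e , i+1<e , e≤d , be , const = e , longRun i+1<e e≤d bi be extended
    where
    extended : Constant l⟨ i ⟩ i e
    extended k i≤k k<e with m≤n⇒m<n∨m≡n i≤k
    ... | inj₁ i<k = trans (const k i<k k<e) (sym same)
    ... | inj₂ refl = refl

  -- Since each label value forms a single run, this counts the runs among the first n steps
  -- plus those of length at least 2.
  occurrenceWeight : ℕ → ℕ
  occurrenceWeight n = sumBelow (length w) (λ p → occurrences p (take n l) ⊓ 2)

  occurrences-take-suc : ∀ p {m} → m < d → occurrences p (take (suc m) l) ≡ occurrences p (take m l) + occurrences p (l⟨ m ⟩ ∷ [])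
  occurrences-take-suc p {m} m<d = trans (cong (occurrences p) (take-suc-at l m m<d)) (occurrences-++ p (take m l) _)

  occurrenceWeight-suc : ∀ {m δ} → m < d → (occurrences l⟨ m ⟩ (take m l) + 1) ⊓ 2 ≡ occurrences l⟨ m ⟩ (take m l) ⊓ 2 + δ →
                         occurrenceWeight (suc m) ≡ occurrenceWeight m + δ
  occurrenceWeight-suc {m} m<d at-l⟨m⟩ = sumBelow-update (length w) (l⟨⟩<length m<d) unchanged
    (trans (cong (_⊓ 2) (trans (occurrences-take-suc l⟨ m ⟩ m<d) (cong (occurrences l⟨ m ⟩ (take m l) +_) (occurrences-self l⟨ m ⟩)))) at-l⟨m⟩)
    where
    unchanged : ∀ {p} → p ≢ l⟨ m ⟩ → occurrences p (take (suc m) l) ⊓ 2 ≡ occurrences p (take m l) ⊓ 2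
    unchanged {p} p≢ = cong (_⊓ 2) (trans (occurrences-take-suc p m<d)
      (trans (cong (occurrences p (take m l) +_) (occurrences-none ((p≢ ∘ sym) ∷ []))) (+-identityʳ _)))

  earlier-occurrences : ∀ {m} → 2 + m ≤ d → LeftEnd m → occurrences l⟨ suc m ⟩ (take m l) ≡ 0
  earlier-occurrences {m} m+2≤d left = occurrences-none (All-take l m λ n n<m _ → >⇒≢ (greater n<m left))
    where
    m<d : m < d
    m<d = <-trans (n<1+n m) m+2≤d
    greater : ∀ {n} → n < m → LeftEnd m → l⟨ suc m ⟩ < l⟨ n ⟩
    greater n<m (inj₁ differ) = <-≤-trans (≤∧≢⇒< (l⟨⟩-antitone (n≤1+n m) m+2≤d) (differ ∘ sym)) (l⟨⟩-antitone (<⇒≤ n<m) m<d)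
    greater n<m (inj₂ bm) = ≤-<-trans (l⟨⟩-antitone (n≤1+n m) m+2≤d) (boundary⇒earlier> bm m<d n<m)

  occurrenceWeight-suc-leftEnd : ∀ {m} → 2 + m ≤ d → LeftEnd m → occurrenceWeight (2 + m) ≡ occurrenceWeight (suc m) + 1
  occurrenceWeight-suc-leftEnd {m} m+2≤d left = occurrenceWeight-suc m+2≤d (lemma (occ (take (suc m) l)) atMostOne)
    where
    occ : List ℕ → ℕ
    occ = occurrences l⟨ suc m ⟩
    atMostOne : occ (take (suc m) l) ≤ 1
    atMostOne = begin
      occ (take (suc m) l)                ≡⟨ occurrences-take-suc l⟨ suc m ⟩ (<-trans (n<1+n m) m+2≤d) ⟩
      occ (take m l) + occ (l⟨ m ⟩ ∷ [])  ≡⟨ cong (_+ occ (l⟨ m ⟩ ∷ [])) (earlier-occurrences m+2≤d left) ⟩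
      occ (l⟨ m ⟩ ∷ [])                   ≤⟨ length-filter (_≟ l⟨ suc m ⟩) (l⟨ m ⟩ ∷ []) ⟩
      1                                   ∎
      where open ≤-Reasoning
    lemma : ∀ c → c ≤ 1 → (c + 1) ⊓ 2 ≡ c ⊓ 2 + 1
    lemma zero _ = refl
    lemma 1 _ = refl
    lemma (suc (suc c)) (s≤s ())

  occurrenceWeight-suc-¬leftEnd : ∀ {m} → 2 + m ≤ d → ¬ LeftEnd m → occurrenceWeight (2 + m) ≡ occurrenceWeight (suc m) + 0
  occurrenceWeight-suc-¬leftEnd {m} m+2≤d ¬left = occurrenceWeight-suc m+2≤d (lemma (occ (take (suc m) l)) atLeastTwo)
    where
    occ : List ℕ → ℕ
    occ = occurrences l⟨ suc m ⟩
    atLeastTwo : 2 ≤ occ (take (suc m) l)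
    atLeastTwo with ¬boundary⇒continues (¬left ∘ inj₂) | l⟨ m ⟩ ≟ l⟨ suc m ⟩
    ... | _ | no differ = ⊥-elim (¬left (inj₁ differ))
    ... | m₀ , refl , same₀ | yes same = begin
      2                                                       ≡⟨ cong₂ _+_ (occurrences-self l⟨ suc m ⟩) (occurrences-self l⟨ suc m ⟩) ⟨
      occ (l⟨ suc m ⟩ ∷ []) + occ (l⟨ suc m ⟩ ∷ [])           ≡⟨ cong₂ (λ a b → occ (a ∷ []) + occ (b ∷ [])) (trans same₀ same) same ⟨
      occ (l⟨ m₀ ⟩ ∷ []) + occ (l⟨ m ⟩ ∷ [])                  ≤⟨ +-monoˡ-≤ (occ (l⟨ m ⟩ ∷ [])) (m≤n+m (occ (l⟨ m₀ ⟩ ∷ [])) (occ (take m₀ l))) ⟩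
      occ (take m₀ l) + occ (l⟨ m₀ ⟩ ∷ []) + occ (l⟨ m ⟩ ∷ []) ≡⟨ cong (_+ occ (l⟨ m ⟩ ∷ [])) (occurrences-take-suc l⟨ suc m ⟩ m₀<d) ⟨
      occ (take m l) + occ (l⟨ m ⟩ ∷ [])                      ≡⟨ occurrences-take-suc l⟨ suc m ⟩ m<d ⟨
      occ (take (suc m) l)                                    ∎
      where
      open ≤-Reasoning
      m<d : m < d
      m<d = <-trans (n<1+n m) m+2≤d
      m₀<d : m₀ < d
      m₀<d = <-trans (n<1+n m₀) m<d
    lemma : ∀ c → 2 ≤ c → (c + 1) ⊓ 2 ≡ c ⊓ 2 + 0
    lemma (suc zero) (s≤s ())
    lemma (suc (suc c)) _ rewrite ⊓-zeroʳ c | ⊓-zeroʳ (c + 1) = refl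

  leftEnds+1≡occurrenceWeight : ∀ n → suc n ≤ d → count leftEnd? 0 n + 1 ≡ occurrenceWeight (suc n)
  leftEnds+1≡occurrenceWeight zero 1≤d = sym (trans (occurrenceWeight-suc 1≤d refl) (cong (_+ 1) (sumBelow-zero (length w))))
  leftEnds+1≡occurrenceWeight (suc n) n+2≤d = trans (cong (_+ 1) (count-suc leftEnd? 0 n)) (byCase (leftEnd? n))
    where
    open ≡-Reasoning
    c : ℕ
    c = count leftEnd? 0 n
    previous : c + 1 ≡ occurrenceWeight (suc n)
    previous = leftEnds+1≡occurrenceWeight n (<⇒≤ n+2≤d)
    byCase : Dec (LeftEnd n) → c + length (filter leftEnd? (n ∷ [])) + 1 ≡ occurrenceWeight (2 + n)
    byCase (yes left) = begin
      c + length (filter leftEnd? (n ∷ [])) + 1  ≡⟨ cong (λ xs → c + length xs + 1) (filter-accept leftEnd? left) ⟩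
      c + 1 + 1                                  ≡⟨ cong (_+ 1) previous ⟩
      occurrenceWeight (suc n) + 1               ≡⟨ occurrenceWeight-suc-leftEnd n+2≤d left ⟨
      occurrenceWeight (2 + n)                   ∎
    byCase (no ¬left) = begin
      c + length (filter leftEnd? (n ∷ [])) + 1  ≡⟨ cong (λ xs → c + length xs + 1) (filter-reject leftEnd? ¬left) ⟩
      c + 0 + 1                                  ≡⟨ cong (_+ 1) (+-identityʳ c) ⟩
      c + 1                                      ≡⟨ previous ⟩
      occurrenceWeight (suc n)                   ≡⟨ +-identityʳ _ ⟨
      occurrenceWeight (suc n) + 0               ≡⟨ occurrenceWeight-suc-¬leftEnd n+2≤d ¬left ⟨
      occurrenceWeight (2 + n)                   ∎

  occurrenceWeight≡d+2D : occurrenceWeight d ≡ dCount η w + 2 * DCount η w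
  occurrenceWeight≡d+2D = begin
    sumBelow (length w) (λ p → occurrences p (take d l) ⊓ 2) ≡⟨ sumBelow-cong (length w) (λ {p} p<w → cong (λ xs → occurrences p xs ⊓ 2) (take-all d l ≤-refl)) ⟩
    sumBelow (length w) (λ p → occurrences p l ⊓ 2)          ≡⟨ sumBelow-cong (length w) (λ {p} p<w →
                                                                  occurrences⊓2≡weight (labels-occurrences labels p) (positive-at positive p p<w) (normal-values p<w)) ⟩
    sumBelow (length w) (λ p → weight (at η p) (at w p))     ≡⟨ sumBelow-weight η w (Pointwise-length (proj₂ (proj₁ normal))) ⟩
    dCount η w + 2 * DCount η w                              ∎
    where open ≡-Reasoning

  module _ (Is : List (ℕ × ℕ)) (sorted : Linked (λ I J → proj₁ I < proj₁ J) Is) (Is⇔MSI : ∀ I → (I ∈ Is) ⇔ MSI u w C I) where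

    ∈⇒shape : ∀ {I} → I ∈ Is → DescentOrLongRun I
    ∈⇒shape {i , j} I∈ = MSI⇒shape (Equivalence.to (Is⇔MSI (i , j)) I∈)

    shape⇒∈ : ∀ {i j} → DescentOrLongRun (i , j) → (i , j) ∈ Is
    shape⇒∈ {i} {j} shape = Equivalence.from (Is⇔MSI (i , j)) (shape⇒MSI shape)

    interiors-apart : ∀ {I Ks} → DescentOrLongRun I → All DescentOrLongRun Ks → All (λ J → proj₁ I < proj₁ J) Ks →
                      All (Disjoint (interior I)) (map interior Ks)
    interiors-apart shape [] [] = []
    interiors-apart shape (shape′ ∷ shapes′) (lt ∷ lts) =
      (λ (k∈ , k∈′) → <-irrefl (cong proj₁ (shapes-disjoint shape shape′ k∈ k∈′)) lt) ∷ interiors-apart shape shapes′ lts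

    interiors-disjoint : ∀ {Js} → All DescentOrLongRun Js → AllPairs (λ I J → proj₁ I < proj₁ J) Js → AllPairs Disjoint (map interior Js)
    interiors-disjoint [] [] = []
    interiors-disjoint (shape ∷ shapes) (before ∷ sorted′) = interiors-apart shape shapes before ∷ interiors-disjoint shapes sorted′

    interiors-nonEmpty : ∀ {Js} → All DescentOrLongRun Js → All NonEmpty (map interior Js)
    interiors-nonEmpty [] = []
    interiors-nonEmpty (shape ∷ shapes) = nonEmpty shape ∷ interiors-nonEmpty shapes
      where
      nonEmpty : ∀ {i j} → DescentOrLongRun (i , j) → NonEmpty (interior (i , j))
      nonEmpty shape = interior-nonEmpty (proj₁ (shape⇒skipped shape))

    J≡I : Jof (map interior Is) ≡ map interior Is
    J≡I = Jof-disjoint (map interior Is) (interiors-disjoint shapes (Linked⇒AllPairs <-trans sorted)) (interiors-nonEmpty shapes)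
      where
      shapes : All DescentOrLongRun Is
      shapes = All.tabulate ∈⇒shape

    critical : Critical C (Jof (map interior Is))
    critical rewrite J≡I = λ k → covered k , covering k
      where
      covered : ∀ k → k ∈ concat (map interior Is) → 1 ≤ k × suc k < length C
      covered k k∈ with ∈-concat⁻′ (map interior Is) k∈
      ... | _ , k∈I , I∈ with ∈-map⁻ interior I∈
      ...   | (i , j) , IJ∈ , refl with ∈-interior⁻ k∈I | ∈⇒shape IJ∈
      ...     | i<k , k<j | shape = <-≤-trans (s≤s z≤n) i<k , <-≤-trans (s≤s k<j) (proj₁ (proj₂ (shape⇒skipped shape)))
      covering : ∀ k → 1 ≤ k × suc k < length C → k ∈ concat (map interior Is)
      covering k (1≤k , k<C) with shape-cover 1≤k (s≤s⁻¹ (subst (suc k <_) length-C k<C))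
      ... | (i , j) , shape , k∈ = ∈-concat⁺′ k∈ (∈-map⁺ interior (shape⇒∈ shape))

    length-Is : length Is ≡ count leftEnd? 0 (d ∸ 1)
    length-Is = trans (sym (length-map proj₁ Is)) (sorted-length leftEnd? 0 (d ∸ 1) (map proj₁ Is) (Linkedₚ.map⁺ sorted) members)
      where
      members : ∀ i → i ∈ map proj₁ Is ⇔ (0 ≤ i × i < d ∸ 1 × LeftEnd i)
      members i = mk⇔ to from
        where
        to : i ∈ map proj₁ Is → 0 ≤ i × i < d ∸ 1 × LeftEnd i
        to i∈ with ∈-map⁻ proj₁ i∈
        ... | (i , j) , I∈ , refl with shape⇒leftEnd (∈⇒shape I∈)
        ...   | i+2≤d , left = z≤n , m+n≤o⇒m≤o∸n (suc i) {1} (subst (_≤ d) (+-comm 1 (suc i)) i+2≤d) , left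
        from : 0 ≤ i × i < d ∸ 1 × LeftEnd i → i ∈ map proj₁ Is
        from (_ , i<d-1 , left) = ∈-map⁺ proj₁ (shape⇒∈ (proj₂ (leftEnd⇒shape i+2≤d left)))
          where
          1<d : 1 < d
          1<d = m∸n≢0⇒n<m (λ d-1≡0 → <⇒≱ i<d-1 (subst (_≤ i) (sym d-1≡0) z≤n))
          i+2≤d : 2 + i ≤ d
          i+2≤d = subst (_≤ d) (+-comm (suc i) 1) (m≤o∸n⇒m+n≤o (suc i) (<⇒≤ 1<d) i<d-1)

    count-MSIs : u ≢ w → length Is + 1 ≡ dCount η w + 2 * DCount η w
    count-MSIs u≢w = begin
      length Is + 1                   ≡⟨ cong (_+ 1) length-Is ⟩
      count leftEnd? 0 (d ∸ 1) + 1    ≡⟨ leftEnds+1≡occurrenceWeight (d ∸ 1) (≤-reflexive 1+[d-1]≡d) ⟩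
      occurrenceWeight (suc (d ∸ 1))  ≡⟨ cong occurrenceWeight 1+[d-1]≡d ⟩
      occurrenceWeight d              ≡⟨ occurrenceWeight≡d+2D ⟩
      dCount η w + 2 * DCount η w     ∎
      where
      open ≡-Reasoning
      d≢0 : d ≢ 0
      d≢0 d≡0 = u≢w (begin
        u        ≡⟨ nz-η ⟨
        nz η     ≡⟨ cong nz η⟨d⟩ ⟨
        v⟨ d ⟩   ≡⟨ cong v⟨_⟩ d≡0 ⟩
        nz w     ≡⟨ nz-w ⟩
        w        ∎)
      1+[d-1]≡d : suc (d ∸ 1) ≡ d
      1+[d-1]≡d = m+[n∸m]≡n (n≢0⇒n>0 d≢0)

proposition4p5 : (u w : Word) → Positive u → Positive w → u ≼ w → u ≢ w →
    (C : List Word) → MaxChain u w C →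
    (l : List ℕ) (η : List ℕ) → ChainLabels C l η →
    Linked _≥_ l → Normal u w η →
    (Is : List (ℕ × ℕ)) → Linked (λ p q → proj₁ p < proj₁ q) Is →
    (∀ p → (p ∈ Is) ⇔ MSI u w C p) →
    Critical C (Jof (map interior Is)) ×
    (∀ S → (S ∈ Jof (map interior Is)) ⇔ (S ∈ map interior Is)) ×
    length Is + 1 ≡ dCount η w + 2 * DCount η w
proposition4p5 u w _ positive _ u≢w (v₀ ∷ vs) (_ , v₀≡w , _) l η labels decreasing normal Is sorted Is⇔MSI
  with just-injective v₀≡w
... | refl = critical Is sorted Is⇔MSI ,
             (λ S → subst (λ Js → (S ∈ Js) ⇔ (S ∈ map interior Is)) (sym (J≡I Is sorted Is⇔MSI)) ⇔-refl) ,
             count-MSIs Is sorted Is⇔MSI u≢w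
  where open LabelledChain u w positive vs l η labels decreasing normal
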